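{- Let $d\ge4$ be even, $T=\{t_1<\dots<t_n\}\subset\mathbb R$ with $n\ge d+1$, and let $P_\sigma(T)$ be a Veronese $d$-polytope whose signed $\sigma$-decomposition partitions $T$ into two intervals $T=I_1\cup I_2$. Then: (i) if $n=d+2$ and $|I_1|,|I_2|$ are both even, then $P_\sigma(T)$ is a cyclic polytope; (ii) if $n=d+2$ and $|I_1|,|I_2|$ are both odd, then $P_\sigma(T)$ is not neighbourly; (iii) if $n>d+2$, then $P_\sigma(T)$ is not neighbourly. In particular, the polytopes in (ii) and (iii) are not cyclic.
   Context: $\nu_d(t)=(1,t,\dots,t^d)$, $q_\xi(t)=\sum_{i=0}^d\xi_it^i$. A chamber $\sigma$ is the closure of a connected component of the complement in $\mathbb R^{d+1}$ of the hyperplanes $\{\xi:q_\xi(t)=0\}$, $t\in T$; $P_\sigma(T)=\mathrm{conv}\{\nu_d(t)/q_\xi(t):t\in T\}$ for any $\xi$ in the interior of $\sigma$ (combinatorial type independent of this choice). The signed $\sigma$-decomposition partitions $T$ into the maximal runs $I_1<I_2<\dots$ of consecutive elements on which $\mathrm{sgn}\,q_\xi$ is constant. A cyclic polytope is a polytope combinatorially equivalent to $\mathrm{conv}\{\nu_d(s):s\in T'\}$ for some finite $T'\subset\mathbb R$ (equivalently to $C_d(n)$). A polytope is $k$-neighbourly if every set of at most $k$ vertices is the vertex set of a face; neighbourly means $\lfloor d/2\rfloor$-neighbourly. -}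

module Defs where

open import Data.Nat as ℕ using (ℕ; zero; suc)
open import Data.Fin as Fin using (Fin; toℕ)
open import Data.Fin.Subset using (Subset; _∈_; _∉_; ∣_∣)
open import Data.Vec as Vec using ()
open import Data.Product using (Σ; ∃; ∃-syntax; _×_; _,_)
open import Data.Sum using (_⊎_)
open import Relation.Binary.PropositionalEquality using (_≡_)
open import Relation.Nullary using (¬_)
open import Function.Bundles using (_↔_; _⇔_; Inverse)

-- The real numbers, axiomatised as a complete (Dedekind/sup-complete)
-- ordered field.  Every such structure is isomorphic to ℝ, so
-- quantifying over all of them is the same as working in ℝ.

record RealField : Set₁ where
  infixl 6 _+_
  infixl 7 _*_
  infix 4 _<_ _≤_
  field
    R      : Set
    0r 1r  : R
    _+_ _*_ : R → R → R
    -_     : R → R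
    inv    : (x : R) → ¬ (x ≡ 0r) → R
    _<_    : R → R → Set
    +-assoc    : ∀ x y z → (x + y) + z ≡ x + (y + z)
    +-comm     : ∀ x y → x + y ≡ y + x
    +-identity : ∀ x → 0r + x ≡ x
    +-inverse  : ∀ x → x + (- x) ≡ 0r
    *-assoc    : ∀ x y z → (x * y) * z ≡ x * (y * z)
    *-comm     : ∀ x y → x * y ≡ y * x
    *-identity : ∀ x → 1r * x ≡ x
    distrib    : ∀ x y z → x * (y + z) ≡ x * y + x * z
    0≢1        : ¬ (0r ≡ 1r)
    inv-correct : ∀ x (nz : ¬ (x ≡ 0r)) → x * inv x nz ≡ 1r
    <-irrefl   : ∀ x → ¬ (x < x)
    <-trans    : ∀ {x y z} → x < y → y < z → x < z
    <-trichotomy : ∀ x y → x < y ⊎ (x ≡ y ⊎ y < x)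
    +-mono-<   : ∀ {x y} z → x < y → x + z < y + z
    *-pos      : ∀ {x y} → 0r < x → 0r < y → 0r < x * y
  _≤_ : R → R → Set
  x ≤ y = x < y ⊎ x ≡ y
  field
    sup : (P : R → Set) → ∃ P → (∃[ b ] (∀ x → P x → x ≤ b)) →
          ∃[ s ] ((∀ x → P x → x ≤ s) × (∀ b → (∀ x → P x → x ≤ b) → s ≤ b))

module _ (F : RealField) where
  open RealField F

  sumF : ∀ {k} → (Fin k → R) → R
  sumF {zero}  f = 0r
  sumF {suc k} f = f Fin.zero + sumF (λ i → f (Fin.suc i))

  dot : ∀ {k} → (Fin k → R) → (Fin k → R) → R
  dot u v = sumF (λ i → u i * v i)

  pow : R → ℕ → R
  pow t zero    = 1r
  pow t (suc m) = t * pow t m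

  ν : (d : ℕ) → R → Fin (suc d) → R
  ν d t j = pow t (toℕ j)

  q : (d : ℕ) → (Fin (suc d) → R) → R → R
  q d ξ t = dot ξ (ν d t)

  StrictlyIncreasing : ∀ {n} → (Fin n → R) → Set
  StrictlyIncreasing T = ∀ i j → i Fin.< j → T i < T j

  -- the points ν_d(t_i)/q_ξ(t_i) whose convex hull is P_σ(T),
  -- for ξ off every hyperplane {q_ξ(t_i) = 0}
  veronesePoints : (d : ℕ) {n : ℕ} (ξ : Fin (suc d) → R) (T : Fin n → R) →
                   (∀ i → ¬ (q d ξ (T i) ≡ 0r)) → Fin n → Fin (suc d) → R
  veronesePoints d ξ T nz i j = inv (q d ξ (T i)) (nz i) * ν d (T i) j

  IsFace : ∀ {m D} → (Fin m → Fin D → R) → Subset m → Set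
  IsFace {m} {D} p S =
    ∃[ c ] ∃[ b ] ((∀ i → i ∈ S → dot {D} c (p i) ≡ b) ×
                   (∀ i → i ∉ S → dot {D} c (p i) < b))

  CombEquiv : ∀ {m m' D D'} → (Fin m → Fin D → R) → (Fin m' → Fin D' → R) → Set
  CombEquiv {m} {m'} p p' =
    Σ (Fin m ↔ Fin m') λ f →
      ∀ (S' : Subset m') →
        IsFace p (Vec.tabulate (λ i → Vec.lookup S' (Inverse.to f i))) ⇔ IsFace p' S'

  Cyclic : ∀ {m D} → (d : ℕ) → (Fin m → Fin D → R) → Set
  Cyclic d p = ∃[ m' ] ∃[ T' ] (StrictlyIncreasing {m'} T' × CombEquiv p (λ i → ν d (T' i)))

  Neighbourly : ∀ {m D} → ℕ → (Fin m → Fin D → R) → Set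
  Neighbourly {m} k p = ∀ (S : Subset m) → ∣ S ∣ ℕ.≤ k → IsFace p S

  -- The signed σ-decomposition of T (for ξ in the interior of σ) consists of
  -- exactly the two runs I₁ = {t_i : i < k}, I₂ = {t_i : i ≥ k}.
  TwoRunSplit : (d : ℕ) {n : ℕ} → (Fin (suc d) → R) → (Fin n → R) → ℕ → Set
  TwoRunSplit d {n} ξ T k =
    (0 ℕ.< k) × (k ℕ.< n) ×
    (∀ i j → toℕ i ℕ.< k → toℕ j ℕ.< k → 0r < q d ξ (T i) * q d ξ (T j)) ×
    (∀ i j → k ℕ.≤ toℕ i → k ℕ.≤ toℕ j → 0r < q d ξ (T i) * q d ξ (T j)) ×
    (∀ i j → toℕ i ℕ.< k → k ℕ.≤ toℕ j → q d ξ (T i) * q d ξ (T j) < 0r)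

module Submission where

-- A subset S of the points ν(tᵢ)/q(tᵢ) spans a face iff some polynomial f of degree ≤ d vanishes on S and
-- has the sign of −q elsewhere (f = c·ν − b q for a supporting hyperplane c = b).  For d + 2 nodes
-- t₀ < ⋯ < t_{d+1} the value vectors of such polynomials are exactly the v with Σ μⱼ vⱼ = 0, where the
-- Lagrange weights μⱼ alternate in sign; so which S are faces depends only on the signs of μⱼ / q(tⱼ).
-- On d + 2 consecutive nodes meeting I₁ in an odd number of points these signs are constant off a set of
-- d/2 nodes, which therefore is no face: the polytope is not neighbourly, hence not cyclic, since cyclic
-- polytopes are neighbourly (take f = −∏_{s ∈ S} (t − s)²).  If n = d + 2 and |I₁|, |I₂| are even,
-- exchanging neighbouring nodes inside I₂ turns the sign pattern into that of the moment curve, and the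
-- relabelling is a combinatorial equivalence with the cyclic polytope.

open import Defs

open import Algebra.Bundles using (CommutativeRing)
open import Algebra.Solver.Ring.AlmostCommutativeRing using (fromCommutativeRing; _-Raw-AlmostCommutative⟶_)
open import Data.Bool using (Bool; true; false; if_then_else_)
open import Data.Empty using (⊥-elim)
open import Data.Fin as Fin using (Fin; toℕ; punchIn)
open import Data.Fin.Permutation using (flip)
import Data.Fin.Properties as Finₚ
open import Data.Fin.Subset using (Subset; _∈_; _∉_; ∣_∣)
open import Data.Fin.Subset.Properties using (_∈?_)
open import Data.Integer as ℤ using (ℤ; -[1+_]; _⊖_)
import Data.Integer.Properties as ℤₚ
open import Data.Maybe using (Maybe; just; nothing)
open import Data.Nat as ℕ using (ℕ; zero; suc; _∸_; _≤_; z≤n; s≤s; ⌊_/2⌋; parity)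
open import Data.Nat.Divisibility using (_∣_; divides; _∣?_)
import Data.Nat.Properties as ℕₚ
open import Data.Parity as ℙ using (Parity; 0ℙ; 1ℙ; _⁻¹)
import Data.Parity.Properties as ℙₚ
open import Data.Product using (Σ-syntax; ∃-syntax; _×_; _,_; proj₁; proj₂)
open import Data.Sign as Sign using (Sign)
open import Data.Sum using (_⊎_; inj₁; inj₂)
open import Data.Vec as Vec using (Vec; []; _∷_; _∷ʳ_; tabulate; lookup; here; there)
import Data.Vec.Properties as Vecₚ
open import Function using (_∘_)
open import Function.Bundles using (_↔_; _⇔_; Inverse; Equivalence; mk⇔; mk↔ₛ′)
open import Function.Definitions using (Injective)
open import Relation.Binary.Definitions using (tri<; tri≈; tri>)
open import Relation.Binary.PropositionalEquality
open import Relation.Nullary using (¬_; yes; no)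

module _ where
  open import Data.Nat using (_+_; _*_; _<_)

  punchIn-< : ∀ {n} (k : Fin (suc n)) (m : Fin n) → toℕ m < toℕ k → toℕ (punchIn k m) < toℕ k
  punchIn-< (Fin.suc k) Fin.zero    _         = s≤s z≤n
  punchIn-< (Fin.suc k) (Fin.suc m) (s≤s m<k) = s≤s (punchIn-< k m m<k)

  punchIn-> : ∀ {n} (k : Fin (suc n)) (m : Fin n) → toℕ k ≤ toℕ m → toℕ k < toℕ (punchIn k m)
  punchIn-> Fin.zero    m           _         = s≤s z≤n
  punchIn-> (Fin.suc k) (Fin.suc m) (s≤s k≤m) = s≤s (punchIn-> k m k≤m)

  parity-∸ : ∀ {m n} → m ≤ n → parity n ℙ.+ parity (n ∸ m) ≡ parity m
  parity-∸ {m} {n} m≤n = begin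
    parity n ℙ.+ p               ≡⟨ cong (λ k → parity k ℙ.+ p) (sym (ℕₚ.m+[n∸m]≡n m≤n)) ⟩
    parity (m + (n ∸ m)) ℙ.+ p   ≡⟨ cong (ℙ._+ p) (ℙₚ.+-homo-+ m (n ∸ m)) ⟩
    (parity m ℙ.+ p) ℙ.+ p       ≡⟨ ℙₚ.+-assoc (parity m) p p ⟩
    parity m ℙ.+ (p ℙ.+ p)       ≡⟨ cong (parity m ℙ.+_) (ℙₚ.p+p≡0ℙ p) ⟩
    parity m ℙ.+ 0ℙ              ≡⟨ ℙₚ.+-identityʳ _ ⟩
    parity m                     ∎
    where
    open ≡-Reasoning
    p = parity (n ∸ m)

  ⌊n/2⌋*2≤n : ∀ n → ⌊ n /2⌋ * 2 ≤ n
  ⌊n/2⌋*2≤n zero          = z≤n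
  ⌊n/2⌋*2≤n (suc zero)    = z≤n
  ⌊n/2⌋*2≤n (suc (suc n)) = s≤s (s≤s (⌊n/2⌋*2≤n n))

  parity-suc : ∀ n → parity (suc n) ≡ parity n ⁻¹
  parity-suc n = ℙₚ.+-homo-+ 1 n

  parity-*2 : ∀ m → parity (m * 2) ≡ 0ℙ
  parity-*2 zero    = refl
  parity-*2 (suc m) = parity-*2 m

  ⌊m*2/2⌋≡m : ∀ m → ⌊ m * 2 /2⌋ ≡ m
  ⌊m*2/2⌋≡m zero    = refl
  ⌊m*2/2⌋≡m (suc m) = cong suc (⌊m*2/2⌋≡m m)

  swapPairsFrom : ℕ → ℕ → ℕ
  swapPairsFrom zero    zero          = 1
  swapPairsFrom zero    (suc zero)    = 0
  swapPairsFrom zero    (suc (suc j)) = suc (suc (swapPairsFrom zero j))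
  swapPairsFrom (suc h) zero          = 0
  swapPairsFrom (suc h) (suc zero)    = 1
  swapPairsFrom (suc h) (suc (suc j)) = suc (suc (swapPairsFrom h j))

  swapPairsFrom-involutive : ∀ h j → swapPairsFrom h (swapPairsFrom h j) ≡ j
  swapPairsFrom-involutive zero    zero          = refl
  swapPairsFrom-involutive zero    (suc zero)    = refl
  swapPairsFrom-involutive zero    (suc (suc j)) = cong (suc ∘ suc) (swapPairsFrom-involutive zero j)
  swapPairsFrom-involutive (suc h) zero          = refl
  swapPairsFrom-involutive (suc h) (suc zero)    = refl
  swapPairsFrom-involutive (suc h) (suc (suc j)) = cong (suc ∘ suc) (swapPairsFrom-involutive h j)

  swapPairsFrom-< : ∀ h m j → j < m * 2 → swapPairsFrom h j < m * 2
  swapPairsFrom-< zero    (suc m) zero          _               = s≤s (s≤s z≤n)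
  swapPairsFrom-< zero    (suc m) (suc zero)    _               = s≤s z≤n
  swapPairsFrom-< zero    (suc m) (suc (suc j)) (s≤s (s≤s j<)) = s≤s (s≤s (swapPairsFrom-< zero m j j<))
  swapPairsFrom-< (suc h) (suc m) zero          j<              = j<
  swapPairsFrom-< (suc h) (suc m) (suc zero)    j<              = j<
  swapPairsFrom-< (suc h) (suc m) (suc (suc j)) (s≤s (s≤s j<)) = s≤s (s≤s (swapPairsFrom-< h m j j<))

  swapPairsFrom-below : ∀ h j → j < h * 2 → swapPairsFrom h j ≡ j
  swapPairsFrom-below (suc h) zero          _               = refl
  swapPairsFrom-below (suc h) (suc zero)    _               = refl
  swapPairsFrom-below (suc h) (suc (suc j)) (s≤s (s≤s j<)) = cong (suc ∘ suc) (swapPairsFrom-below h j j<)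

  swapPairsFrom-parity : ∀ h j → h * 2 ≤ j → parity (suc (swapPairsFrom h j)) ≡ parity (suc j) ℙ.+ 1ℙ
  swapPairsFrom-parity zero    zero          _               = refl
  swapPairsFrom-parity zero    (suc zero)    _               = refl
  swapPairsFrom-parity zero    (suc (suc j)) _               = swapPairsFrom-parity zero j z≤n
  swapPairsFrom-parity (suc h) (suc (suc j)) (s≤s (s≤s h≤j)) = swapPairsFrom-parity h j h≤j

  swapPairsFromFin : ∀ h m → Fin (m * 2) → Fin (m * 2)
  swapPairsFromFin h m i = Fin.fromℕ< (swapPairsFrom-< h m (toℕ i) (Finₚ.toℕ<n i))

  toℕ-swapPairsFromFin : ∀ h m i → toℕ (swapPairsFromFin h m i) ≡ swapPairsFrom h (toℕ i)
  toℕ-swapPairsFromFin h m i = Finₚ.toℕ-fromℕ< _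

  swapPairsFrom↔ : ∀ h m → Fin (m * 2) ↔ Fin (m * 2)
  swapPairsFrom↔ h m = mk↔ₛ′ π π involutive involutive
    where
    π = swapPairsFromFin h m
    involutive : ∀ i → π (π i) ≡ i
    involutive i = Finₚ.toℕ-injective (begin
      toℕ (π (π i))                        ≡⟨ toℕ-swapPairsFromFin h m (π i) ⟩
      swapPairsFrom h (toℕ (π i))          ≡⟨ cong (swapPairsFrom h) (toℕ-swapPairsFromFin h m i) ⟩
      swapPairsFrom h (swapPairsFrom h (toℕ i)) ≡⟨ swapPairsFrom-involutive h (toℕ i) ⟩
      toℕ i                                ∎)
      where open ≡-Reasoning

  oddsThen : ℕ → (ℕ → Bool) → ℕ → Bool
  oddsThen zero    χ zero          = false
  oddsThen zero    χ (suc j)       = χ j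
  oddsThen (suc h) χ zero          = false
  oddsThen (suc h) χ (suc zero)    = true
  oddsThen (suc h) χ (suc (suc j)) = oddsThen h χ j

  oddsThen-even : ∀ h χ j → oddsThen h χ j ≡ false → j < suc (h * 2) → parity j ≡ 0ℙ
  oddsThen-even zero    χ zero          _  _               = refl
  oddsThen-even zero    χ (suc j)       _  (s≤s ())
  oddsThen-even (suc h) χ zero          _  _               = refl
  oddsThen-even (suc h) χ (suc zero)    () _
  oddsThen-even (suc h) χ (suc (suc j)) χ≡ (s≤s (s≤s j<)) = oddsThen-even h χ j χ≡ j<

  oddsThen-skip : ∀ h χ j → oddsThen h χ (suc (h * 2) + j) ≡ χ j
  oddsThen-skip zero    χ j = refl
  oddsThen-skip (suc h) χ j = oddsThen-skip h χ j

  oddsThen-0 : ∀ h χ → oddsThen h χ 0 ≡ false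
  oddsThen-0 zero    χ = refl
  oddsThen-0 (suc h) χ = refl

  oddsThen²-parity : ∀ x y j → j < suc (x * 2) + suc (y * 2) →
                     oddsThen x (oddsThen y (λ _ → false)) j ≡ false →
                     (j < suc (x * 2) × parity j ≡ 0ℙ) ⊎ (suc (x * 2) ≤ j × parity j ≡ 1ℙ)
  oddsThen²-parity x y j j<a+b j∉ with j ℕₚ.<? suc (x * 2)
  ... | yes j<a = inj₁ (j<a , oddsThen-even x _ j j∉ j<a)
  ... | no  j≮a = inj₂ (a≤j , (begin
    parity j                ≡⟨ cong parity (sym (ℕₚ.m+[n∸m]≡n a≤j)) ⟩
    parity (a + j′)         ≡⟨ ℙₚ.+-homo-+ a j′ ⟩
    parity a ℙ.+ parity j′  ≡⟨ cong₂ ℙ._+_ (trans (parity-suc (x * 2)) (cong _⁻¹ (parity-*2 x))) j′-even ⟩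
    1ℙ                      ∎))
    where
    open ≡-Reasoning
    a = suc (x * 2)
    a≤j = ℕₚ.≮⇒≥ j≮a
    j′ = j ∸ a
    j′-even : parity j′ ≡ 0ℙ
    j′-even = oddsThen-even y _ j′
      (trans (sym (oddsThen-skip x _ j′)) (trans (cong (oddsThen x _) (ℕₚ.m+[n∸m]≡n a≤j)) j∉))
      (ℕₚ.+-cancelˡ-< a j′ _ (subst (_< a + suc (y * 2)) (sym (ℕₚ.m+[n∸m]≡n a≤j)) j<a+b))

  shiftBy : ℕ → (ℕ → Bool) → ℕ → Bool
  shiftBy zero    χ j       = χ j
  shiftBy (suc o) χ zero    = false
  shiftBy (suc o) χ (suc j) = shiftBy o χ j

  shiftBy-+ : ∀ o χ j → shiftBy o χ (o + j) ≡ χ j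
  shiftBy-+ zero    χ j = refl
  shiftBy-+ (suc o) χ j = shiftBy-+ o χ j

  AtMost : ℕ → (ℕ → Bool) → Set
  AtMost B χ = ∀ n → ∣ tabulate {n = n} (χ ∘ toℕ) ∣ ≤ B

  AtMost-none : AtMost 0 (λ _ → false)
  AtMost-none zero    = z≤n
  AtMost-none (suc n) = AtMost-none n

  AtMost-shiftBy : ∀ {B χ} o → AtMost B χ → AtMost B (shiftBy o χ)
  AtMost-shiftBy zero    χ≤ n       = χ≤ n
  AtMost-shiftBy (suc o) χ≤ zero    = z≤n
  AtMost-shiftBy (suc o) χ≤ (suc n) = AtMost-shiftBy o χ≤ n

  AtMost-oddsThen : ∀ {B χ} h → AtMost B χ → AtMost (h + B) (oddsThen h χ)
  AtMost-oddsThen zero    χ≤ zero          = z≤n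
  AtMost-oddsThen zero    χ≤ (suc n)       = χ≤ n
  AtMost-oddsThen (suc h) χ≤ zero          = z≤n
  AtMost-oddsThen (suc h) χ≤ (suc zero)    = z≤n
  AtMost-oddsThen (suc h) χ≤ (suc (suc n)) = s≤s (AtMost-oddsThen h χ≤ n)

  ∈-tabulate⁺ : ∀ {n} {g : Fin n → Bool} i → g i ≡ true → i ∈ tabulate g
  ∈-tabulate⁺ {g = g} i gᵢ≡true =
    Vecₚ.lookup⇒[]= i (tabulate g) (trans (Vecₚ.lookup∘tabulate g i) gᵢ≡true)

  ∈-tabulate⁻ : ∀ {n} {g : Fin n → Bool} {i} → i ∈ tabulate g → g i ≡ true
  ∈-tabulate⁻ {g = g} {i} i∈ = trans (sym (Vecₚ.lookup∘tabulate g i)) (Vecₚ.[]=⇒lookup i∈)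

  -- d + 2 consecutive indices offset, …, offset + d + 1: the first 2x + 1 in I₁, the last 2y + 1 in I₂.
  record OddWindow (d n k : ℕ) : Set where
    field
      offset x y : ℕ
      splits     : offset + suc (x * 2) ≡ k
      size       : (x + y) * 2 ≡ d
      fits       : offset + suc (suc d) ≤ n

    index : Fin (suc (suc d)) → Fin n
    index j = Fin.fromℕ< (ℕₚ.<-≤-trans (ℕₚ.+-monoʳ-< offset (Finₚ.toℕ<n j)) fits)

    toℕ-index : ∀ j → toℕ (index j) ≡ offset + toℕ j
    toℕ-index j = Finₚ.toℕ-fromℕ< _

    index-mono : ∀ i j → toℕ i < toℕ j → toℕ (index i) < toℕ (index j)
    index-mono i j i<j = subst₂ _<_ (sym (toℕ-index i)) (sym (toℕ-index j)) (ℕₚ.+-monoʳ-< offset i<j)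

    index-below : ∀ j → toℕ j < suc (x * 2) → toℕ (index j) < k
    index-below j j<a = subst₂ _<_ (sym (toℕ-index j)) splits (ℕₚ.+-monoʳ-< offset j<a)

    index-above : ∀ j → suc (x * 2) ≤ toℕ j → k ≤ toℕ (index j)
    index-above j a≤j = subst₂ _≤_ splits (sym (toℕ-index j)) (ℕₚ.+-monoʳ-≤ offset a≤j)

    oddPositions : ℕ → Bool
    oddPositions = oddsThen x (oddsThen y (λ _ → false))

    subset : Subset n
    subset = tabulate (shiftBy offset oddPositions ∘ toℕ)

    ∣subset∣≤ : ∣ subset ∣ ≤ ⌊ d /2⌋
    ∣subset∣≤ = subst (∣ subset ∣ ≤_) x+y≡⌊d/2⌋
      (AtMost-shiftBy offset (AtMost-oddsThen x (AtMost-oddsThen y AtMost-none)) n)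
      where
      x+y≡⌊d/2⌋ : x + (y + 0) ≡ ⌊ d /2⌋
      x+y≡⌊d/2⌋ = trans (cong (x +_) (ℕₚ.+-identityʳ y)) (trans (sym (⌊m*2/2⌋≡m (x + y))) (cong ⌊_/2⌋ size))

    restricted : Subset (suc (suc d))
    restricted = tabulate (lookup subset ∘ index)

    restricted≡oddPositions : ∀ j → lookup subset (index j) ≡ oddPositions (toℕ j)
    restricted≡oddPositions j = trans (Vecₚ.lookup∘tabulate _ (index j))
      (trans (cong (shiftBy offset oddPositions) (toℕ-index j)) (shiftBy-+ offset oddPositions (toℕ j)))

    0∉restricted : Fin.zero ∉ restricted
    0∉restricted 0∈ with trans (sym (oddsThen-0 x _)) (trans (sym (restricted≡oddPositions Fin.zero))
                                                             (∈-tabulate⁻ {g = lookup subset ∘ index} 0∈))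
    ... | ()

    ∉restricted-parity : ∀ j → j ∉ restricted →
                         (toℕ j < suc (x * 2) × parity (toℕ j) ≡ 0ℙ) ⊎
                         (suc (x * 2) ≤ toℕ j × parity (toℕ j) ≡ 1ℙ)
    ∉restricted-parity j j∉ =
      oddsThen²-parity x y (toℕ j) (subst (toℕ j <_) window-size (Finₚ.toℕ<n j)) outside
      where
      window-size : suc (suc d) ≡ suc (x * 2) + suc (y * 2)
      window-size = cong suc (trans (cong suc (trans (sym size) (ℕₚ.*-distribʳ-+ 2 x y))) (sym (ℕₚ.+-suc _ _)))
      outside : oddPositions (toℕ j) ≡ false
      outside with oddPositions (toℕ j) in oddⱼ
      ... | false = refl
      ... | true  = ⊥-elim (j∉ (∈-tabulate⁺ {g = lookup subset ∘ index} j
                                 (trans (restricted≡oddPositions j) oddⱼ)))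

  even-or-odd : ∀ k → ∃[ x ] (k ≡ x * 2 ⊎ k ≡ suc (x * 2))
  even-or-odd zero = 0 , inj₁ refl
  even-or-odd (suc k) with even-or-odd k
  ... | x , inj₁ refl = x , inj₂ refl
  ... | x , inj₂ refl = suc x , inj₁ refl

  oddWindow-late : ∀ {d n k} → 2 ∣ d → k < n → d < k → OddWindow d n k
  oddWindow-late {n = n} {k} (divides h refl) k<n d<k = record
    { offset = k ∸ suc (h * 2) ; x = h ; y = 0
    ; splits = ℕₚ.m∸n+n≡m d<k
    ; size   = cong (_* 2) (ℕₚ.+-identityʳ h)
    ; fits   = subst (_≤ n) (sym (trans (ℕₚ.+-suc _ _) (cong suc (ℕₚ.m∸n+n≡m d<k)))) k<n
    }

  oddWindow-odd : ∀ {d n k} → 2 ∣ d → suc (suc d) ≤ n → k ≤ d → ¬ 2 ∣ k → OddWindow d n k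
  oddWindow-odd {k = k} (divides h refl) d+2≤n k≤d k-odd with even-or-odd k
  ... | x , inj₁ refl = ⊥-elim (k-odd (divides x refl))
  ... | x , inj₂ refl = record
    { offset = 0 ; x = x ; y = h ∸ x
    ; splits = refl
    ; size   = cong (_* 2) (ℕₚ.m+[n∸m]≡n x≤h)
    ; fits   = d+2≤n
    }
    where
    x≤h : x ≤ h
    x≤h = ℕₚ.*-cancelʳ-≤ x h 2 (ℕₚ.<⇒≤ k≤d)

  oddWindow-even : ∀ {d n k} → 2 ∣ d → suc (suc (suc d)) ≤ n → k ≤ d → 0 < k → 2 ∣ k → OddWindow d n k
  oddWindow-even (divides h refl) d+3≤n k≤d 0<k (divides (suc x) refl) = record
    { offset = 1 ; x = x ; y = h ∸ x
    ; splits = refl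
    ; size   = cong (_* 2) (ℕₚ.m+[n∸m]≡n x≤h)
    ; fits   = d+3≤n
    }
    where
    x≤h : x ≤ h
    x≤h = ℕₚ.*-cancelʳ-≤ x h 2 (ℕₚ.≤-trans (ℕₚ.n≤1+n _) (ℕₚ.<⇒≤ k≤d))

  oddWindow-exact : ∀ {d n k} → 2 ∣ d → n ≡ d + 2 → k < n → ¬ 2 ∣ k → OddWindow d n k
  oddWindow-exact {d} {k = k} 2∣d n≡d+2 k<n k-odd with d ℕₚ.<? k
  ... | yes d<k = oddWindow-late 2∣d k<n d<k
  ... | no  d≮k =
    oddWindow-odd 2∣d (ℕₚ.≤-reflexive (sym (trans n≡d+2 (ℕₚ.+-comm d 2)))) (ℕₚ.≮⇒≥ d≮k) k-odd

  oddWindow-large : ∀ {d n k} → 2 ∣ d → d + 2 < n → 0 < k → k < n → OddWindow d n k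
  oddWindow-large {d} {n} {k} 2∣d d+2<n 0<k k<n with d ℕₚ.<? k | 2 ∣? k
  ... | yes d<k | _        = oddWindow-late 2∣d k<n d<k
  ... | no  d≮k | yes 2∣k  = oddWindow-even 2∣d d+3≤n (ℕₚ.≮⇒≥ d≮k) 0<k 2∣k
    where
    d+3≤n : suc (suc (suc d)) ≤ n
    d+3≤n = subst (_< n) (ℕₚ.+-comm d 2) d+2<n
  ... | no  d≮k | no  k-odd =
    oddWindow-odd 2∣d (ℕₚ.<⇒≤ (subst (_< n) (ℕₚ.+-comm d 2) d+2<n)) (ℕₚ.≮⇒≥ d≮k) k-odd

module _ where
  open import Algebra.Properties.CommutativeMonoid.Sum ℕₚ.+-0-commutativeMonoid
    using (sum; sum-permute; sum-cong-≗)

  indicator : ∀ {n} → Subset n → Fin n → ℕ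
  indicator S i = if lookup S i then 1 else 0

  ∣_∣≡sum : ∀ {n} (S : Subset n) → ∣ S ∣ ≡ sum (indicator S)
  ∣ []        ∣≡sum = refl
  ∣ true ∷ S  ∣≡sum = cong suc ∣ S ∣≡sum
  ∣ false ∷ S ∣≡sum = ∣ S ∣≡sum

  ∣∣-relabel : ∀ {m n} (f : Fin m ↔ Fin n) (S : Subset m) → ∣ tabulate (lookup S ∘ Inverse.from f) ∣ ≡ ∣ S ∣
  ∣∣-relabel f S = begin
    ∣ S′ ∣                              ≡⟨ ∣ S′ ∣≡sum ⟩
    sum (indicator S′)
      ≡⟨ sum-cong-≗ (λ i → cong (λ b → if b then 1 else 0) (Vecₚ.lookup∘tabulate (lookup S ∘ Inverse.from f) i)) ⟩
    sum (indicator S ∘ Inverse.from f)  ≡⟨ sym (sum-permute (indicator S) (flip f)) ⟩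
    sum (indicator S)                   ≡⟨ sym ∣ S ∣≡sum ⟩
    ∣ S ∣                               ∎
    where
    open ≡-Reasoning
    S′ = tabulate (lookup S ∘ Inverse.from f)

module _ (F : RealField) where
  open RealField F hiding (_≤_)

  commutativeRing : CommutativeRing _ _
  commutativeRing = record
    { isCommutativeRing = record
      { isRing = record
        { +-isAbelianGroup = record
          { isGroup = record
            { isMonoid = record
              { isSemigroup = record
                { isMagma = record { isEquivalence = isEquivalence ; ∙-cong = cong₂ _+_ }
                ; assoc = +-assoc }
              ; identity = +-identity , λ x → trans (+-comm x 0r) (+-identity x) }
            ; inverse = (λ x → trans (+-comm (- x) x) (+-inverse x)) , +-inverse
            ; ⁻¹-cong = cong -_ }
          ; comm = +-comm }
        ; *-cong = cong₂ _*_
        ; *-assoc = *-assoc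
        ; *-identity = *-identity , λ x → trans (*-comm x 1r) (*-identity x)
        ; distrib = distrib , λ x y z → trans (*-comm (y + z) x)
                                         (trans (distrib x y z) (cong₂ _+_ (*-comm x y) (*-comm x z))) }
      ; *-comm = *-comm } }

  open CommutativeRing commutativeRing
    using (+-identityʳ; *-identityʳ; zeroˡ; zeroʳ; ring; semiring; *-rawMonoid;
           +-abelianGroup; +-commutativeSemigroup; *-commutativeSemigroup)
  open import Algebra.Properties.Ring ring using (-‿distribˡ-*; -‿distribʳ-*; -‿involutive; -0#≈0#; -1*x≈-x)
  open import Algebra.Properties.AbelianGroup +-abelianGroup using (⁻¹-∙-comm)
  open import Algebra.Properties.CommutativeSemigroup +-commutativeSemigroup
    using () renaming (interchange to +-interchange)
  open import Algebra.Properties.CommutativeSemigroup *-commutativeSemigroup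
    using (x∙yz≈y∙xz) renaming (interchange to *-interchange)
  open import Algebra.Properties.Semiring.Mult semiring using (×-homo-+; ×1-homo-*) renaming (_×_ to _×ᵣ_)

  -- ℤ serves as the coefficient ring of the ring solver through the homomorphism ι : ℤ → R.
  module IntegerCoefficients where

    ι : ℤ → R
    ι (ℤ.+ n)  = n ×ᵣ 1r
    ι -[1+ n ] = - (suc n ×ᵣ 1r)

    private
      open ≡-Reasoning

      ι-⊖ : ∀ m n → ι (m ⊖ n) ≡ m ×ᵣ 1r + - (n ×ᵣ 1r)
      ι-⊖ m zero = begin
        ι (m ⊖ 0)          ≡⟨ cong ι (ℤₚ.⊖-≥ {m} z≤n) ⟩
        m ×ᵣ 1r            ≡⟨ sym (+-identityʳ _) ⟩
        m ×ᵣ 1r + 0r       ≡⟨ cong (m ×ᵣ 1r +_) (sym -0#≈0#) ⟩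
        m ×ᵣ 1r + - 0r     ∎
      ι-⊖ zero (suc n) = sym (+-identity _)
      ι-⊖ (suc m) (suc n) = begin
        ι (suc m ⊖ suc n)                      ≡⟨ cong ι (ℤₚ.[1+m]⊖[1+n]≡m⊖n m n) ⟩
        ι (m ⊖ n)                              ≡⟨ ι-⊖ m n ⟩
        a + - b                                ≡⟨ sym (+-identity _) ⟩
        0r + (a + - b)                         ≡⟨ cong (_+ (a + - b)) (sym (+-inverse 1r)) ⟩
        (1r + - 1r) + (a + - b)                ≡⟨ +-interchange 1r (- 1r) a (- b) ⟩
        (1r + a) + (- 1r + - b)                ≡⟨ cong ((1r + a) +_) (⁻¹-∙-comm 1r b) ⟩
        (1r + a) + - (1r + b)                  ∎
        where
        a = m ×ᵣ 1r
        b = n ×ᵣ 1r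

      ι-+ : ∀ x y → ι (x ℤ.+ y) ≡ ι x + ι y
      ι-+ (ℤ.+ m)  (ℤ.+ n)  = ×-homo-+ 1r m n
      ι-+ (ℤ.+ m)  -[1+ n ] = ι-⊖ m (suc n)
      ι-+ -[1+ m ] (ℤ.+ n)  = trans (ι-⊖ n (suc m)) (+-comm _ _)
      ι-+ -[1+ m ] -[1+ n ] = begin
        - (suc (suc (m ℕ.+ n)) ×ᵣ 1r)      ≡⟨ cong (λ z → - (suc z ×ᵣ 1r)) (sym (ℕₚ.+-suc m n)) ⟩
        - ((suc m ℕ.+ suc n) ×ᵣ 1r)        ≡⟨ cong -_ (×-homo-+ 1r (suc m) (suc n)) ⟩
        - (suc m ×ᵣ 1r + suc n ×ᵣ 1r)      ≡⟨ sym (⁻¹-∙-comm _ _) ⟩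
        - (suc m ×ᵣ 1r) + - (suc n ×ᵣ 1r)  ∎

      ι-neg : ∀ x → ι (ℤ.- x) ≡ - ι x
      ι-neg -[1+ n ]    = sym (-‿involutive _)
      ι-neg (ℤ.+ zero)  = sym -0#≈0#
      ι-neg (ℤ.+ suc n) = refl

      ⟦_⟧ : Sign → R
      ⟦ Sign.+ ⟧ = 1r
      ⟦ Sign.- ⟧ = - 1r

      ⟦⟧-* : ∀ s t → ⟦ s Sign.* t ⟧ ≡ ⟦ s ⟧ * ⟦ t ⟧
      ⟦⟧-* Sign.+ t      = sym (*-identity _)
      ⟦⟧-* Sign.- Sign.+ = sym (*-identityʳ _)
      ⟦⟧-* Sign.- Sign.- = sym (trans (-1*x≈-x (- 1r)) (-‿involutive 1r))

      ι-◃ : ∀ s n → ι (s ℤ.◃ n) ≡ ⟦ s ⟧ * (n ×ᵣ 1r)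
      ι-◃ s      zero    = sym (zeroʳ _)
      ι-◃ Sign.+ (suc n) = sym (*-identity _)
      ι-◃ Sign.- (suc n) = sym (-1*x≈-x _)

      ι≡sign*abs : ∀ x → ι x ≡ ⟦ ℤ.sign x ⟧ * (ℤ.∣ x ∣ ×ᵣ 1r)
      ι≡sign*abs (ℤ.+ n)  = sym (*-identity _)
      ι≡sign*abs -[1+ n ] = sym (-1*x≈-x _)

      ι-* : ∀ x y → ι (x ℤ.* y) ≡ ι x * ι y
      ι-* x y = begin
        ι (x ℤ.* y)                                ≡⟨ ι-◃ (sx Sign.* sy) (ax ℕ.* ay) ⟩
        ⟦ sx Sign.* sy ⟧ * ((ax ℕ.* ay) ×ᵣ 1r)     ≡⟨ cong₂ _*_ (⟦⟧-* sx sy) (×1-homo-* ax ay) ⟩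
        (⟦ sx ⟧ * ⟦ sy ⟧) * ((ax ×ᵣ 1r) * (ay ×ᵣ 1r)) ≡⟨ *-interchange _ _ _ _ ⟩
        (⟦ sx ⟧ * (ax ×ᵣ 1r)) * (⟦ sy ⟧ * (ay ×ᵣ 1r)) ≡⟨ sym (cong₂ _*_ (ι≡sign*abs x) (ι≡sign*abs y)) ⟩
        ι x * ι y                                  ∎
        where
        sx = ℤ.sign x
        sy = ℤ.sign y
        ax = ℤ.∣ x ∣
        ay = ℤ.∣ y ∣

    ι-morphism : ℤ.+-*-rawRing -Raw-AlmostCommutative⟶ fromCommutativeRing commutativeRing
    ι-morphism = record
      { ⟦_⟧ = ι ; +-homo = ι-+ ; *-homo = ι-* ; -‿homo = ι-neg ; 0-homo = refl ; 1-homo = +-identityʳ 1r }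

    ι-≟ : ∀ a b → Maybe (ι a ≡ ι b)
    ι-≟ a b with a ℤ.≟ b
    ... | yes a≡b = just (cong ι a≡b)
    ... | no _    = nothing

  open IntegerCoefficients using (ι-morphism; ι-≟)
  open import Algebra.Solver.Ring ℤ.+-*-rawRing (fromCommutativeRing commutativeRing) ι-morphism ι-≟
    using (solve; _:=_; _:+_; _:*_; :-_; _:-_; con)

  <-asym : ∀ {x y} → x < y → ¬ y < x
  <-asym x<y y<x = <-irrefl _ (<-trans x<y y<x)

  <⇒≢ : ∀ {x y} → x < y → x ≢ y
  <⇒≢ {x} x<y refl = <-irrefl x x<y

  <⇒0<y-x : ∀ {x y} → x < y → 0r < y + - x
  <⇒0<y-x {x} {y} x<y = subst (_< y + - x) (+-inverse x) (+-mono-< (- x) x<y)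

  <⇒x-y<0 : ∀ {x y} → x < y → x + - y < 0r
  <⇒x-y<0 {x} {y} x<y = subst (x + - y <_) (+-inverse y) (+-mono-< (- y) x<y)

  y-x≡0⇒x≡y : ∀ {x y} → y + - x ≡ 0r → x ≡ y
  y-x≡0⇒x≡y {x} {y} e = sym (begin
    y                  ≡⟨ solve 2 (λ x y → y := (y :- x) :+ x) refl x y ⟩
    (y + - x) + x      ≡⟨ cong (_+ x) e ⟩
    0r + x             ≡⟨ +-identity x ⟩
    x                  ∎)
    where open ≡-Reasoning

  -- Signs are elements of ℤ/2ℤ (0ℙ positive, 1ℙ negative), so that the sign of
  -- a product is the sum of the signs and (-1)ⁿ has sign parity n.
  HasSign : Parity → R → Set
  HasSign 0ℙ x = 0r < x
  HasSign 1ℙ x = x < 0r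

  HasSign⇒≢0 : ∀ p {x} → HasSign p x → x ≢ 0r
  HasSign⇒≢0 0ℙ 0<x = <⇒≢ 0<x ∘ sym
  HasSign⇒≢0 1ℙ x<0 = <⇒≢ x<0

  HasSign-unique : ∀ p q {x} → HasSign p x → HasSign q x → p ≡ q
  HasSign-unique 0ℙ 0ℙ _ _ = refl
  HasSign-unique 0ℙ 1ℙ 0<x x<0 = ⊥-elim (<-asym 0<x x<0)
  HasSign-unique 1ℙ 0ℙ x<0 0<x = ⊥-elim (<-asym 0<x x<0)
  HasSign-unique 1ℙ 1ℙ _ _ = refl

  sign : ∀ x → x ≢ 0r → ∃[ p ] HasSign p x
  sign x x≢0 with <-trichotomy 0r x
  ... | inj₁ 0<x        = 0ℙ , 0<x
  ... | inj₂ (inj₁ 0≡x) = ⊥-elim (x≢0 (sym 0≡x))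
  ... | inj₂ (inj₂ x<0) = 1ℙ , x<0

  HasSign-neg : ∀ p {x} → HasSign p x → HasSign (p ⁻¹) (- x)
  HasSign-neg 0ℙ {x} 0<x = subst₂ _<_ (+-identity (- x)) (+-inverse x) (+-mono-< (- x) 0<x)
  HasSign-neg 1ℙ {x} x<0 = subst₂ _<_ (+-inverse x) (+-identity (- x)) (+-mono-< (- x) x<0)

  HasSign-* : ∀ p q {x y} → HasSign p x → HasSign q y → HasSign (p ℙ.+ q) (x * y)
  HasSign-* 0ℙ 0ℙ         0<x 0<y = *-pos 0<x 0<y
  HasSign-* 0ℙ 1ℙ {x} {y} 0<x y<0 = subst (_< 0r) (-‿involutive (x * y))
    (HasSign-neg 0ℙ (subst (0r <_) (sym (-‿distribʳ-* x y)) (*-pos 0<x (HasSign-neg 1ℙ y<0))))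
  HasSign-* 1ℙ 0ℙ {x} {y} x<0 0<y = subst (_< 0r) (*-comm y x) (HasSign-* 0ℙ 1ℙ 0<y x<0)
  HasSign-* 1ℙ 1ℙ {x} {y} x<0 y<0 = subst (0r <_) (solve 2 (λ x y → (:- x) :* (:- y) := x :* y) refl x y)
    (*-pos (HasSign-neg 1ℙ x<0) (HasSign-neg 1ℙ y<0))

  0<1 : 0r < 1r
  0<1 with <-trichotomy 0r 1r
  ... | inj₁ 0<1        = 0<1
  ... | inj₂ (inj₁ 0≡1) = ⊥-elim (0≢1 0≡1)
  ... | inj₂ (inj₂ 1<0) = ⊥-elim (<-asym 1<0 (subst (0r <_) (*-identity 1r) (HasSign-* 1ℙ 1ℙ 1<0 1<0)))

  0<x*x : ∀ {x} → x ≢ 0r → 0r < x * x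
  0<x*x {x} x≢0 with sign x x≢0
  ... | p , hx = subst (λ p → HasSign p (x * x)) (ℙₚ.p+p≡0ℙ p) (HasSign-* p p hx hx)

  HasSign-*⇒≢0ʳ : ∀ p {x y} → HasSign p (x * y) → y ≢ 0r
  HasSign-*⇒≢0ʳ p {x} hxy y≡0 = HasSign⇒≢0 p hxy (trans (cong (x *_) y≡0) (zeroʳ x))

  HasSign-factor : ∀ p q {x y} → HasSign p x → HasSign q (x * y) → HasSign (p ℙ.+ q) y
  HasSign-factor p q {x} {y} hx hxy with sign y (HasSign-*⇒≢0ʳ q hxy)
  ... | r , hy = subst (λ r → HasSign r y) r≡p+q hy
    where
    r≡p+q : r ≡ p ℙ.+ q
    r≡p+q = begin
      r                ≡⟨⟩
      0ℙ ℙ.+ r         ≡⟨ cong (ℙ._+ r) (sym (ℙₚ.p+p≡0ℙ p)) ⟩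
      (p ℙ.+ p) ℙ.+ r  ≡⟨ ℙₚ.+-assoc p p r ⟩
      p ℙ.+ (p ℙ.+ r)  ≡⟨ cong (p ℙ.+_) (HasSign-unique _ _ (HasSign-* p r hx hy) hxy) ⟩
      p ℙ.+ q          ∎
      where open ≡-Reasoning

  -- (x y) (y z) = y² (x z)
  HasSign-cancel : ∀ p q {x y z} → HasSign p (x * y) → HasSign q (y * z) → HasSign (p ℙ.+ q) (x * z)
  HasSign-cancel p q {x} {y} {z} hxy hyz = HasSign-factor 0ℙ (p ℙ.+ q) (0<x*x (HasSign-*⇒≢0ʳ p hxy))
    (subst (HasSign (p ℙ.+ q)) (solve 3 (λ x y z → (x :* y) :* (y :* z) := (y :* y) :* (x :* z)) refl x y z)
      (HasSign-* p q hxy hyz))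

  inv-≢0 : ∀ {x} (x≢0 : x ≢ 0r) → inv x x≢0 ≢ 0r
  inv-≢0 {x} x≢0 = HasSign-*⇒≢0ʳ 0ℙ (subst (0r <_) (sym (inv-correct x x≢0)) 0<1)

  HasSign-inv : ∀ p {x} (x≢0 : x ≢ 0r) → HasSign p x → HasSign p (inv x x≢0)
  HasSign-inv p {x} x≢0 hx = subst (λ r → HasSign r (inv x x≢0)) (ℙₚ.+-identityʳ p)
    (HasSign-factor p 0ℙ hx (subst (0r <_) (sym (inv-correct x x≢0)) 0<1))

  HasSign-+ : ∀ p {x y} → HasSign p x → HasSign p y → HasSign p (x + y)
  HasSign-+ 0ℙ {x} {y} 0<x 0<y = <-trans 0<y (subst (_< x + y) (+-identity y) (+-mono-< y 0<x))
  HasSign-+ 1ℙ {x} {y} x<0 y<0 = <-trans (subst (x + y <_) (+-identity y) (+-mono-< y x<0)) y<0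

  HasWeakSign : Parity → R → Set
  HasWeakSign p x = x ≡ 0r ⊎ HasSign p x

  HasWeakSign-+ : ∀ p {x y} → HasWeakSign p x → HasWeakSign p y → HasWeakSign p (x + y)
  HasWeakSign-+ p {y = y} (inj₁ refl) hy = subst (HasWeakSign p) (sym (+-identity y)) hy
  HasWeakSign-+ p {x} (inj₂ hx) (inj₁ refl) = inj₂ (subst (HasSign p) (sym (+-identityʳ x)) hx)
  HasWeakSign-+ p (inj₂ hx) (inj₂ hy) = inj₂ (HasSign-+ p hx hy)

  HasSign-+-weak : ∀ p {x y} → HasSign p x → HasWeakSign p y → HasSign p (x + y)
  HasSign-+-weak p {x} hx (inj₁ refl) = subst (HasSign p) (sym (+-identityʳ x)) hx
  HasSign-+-weak p hx (inj₂ hy) = HasSign-+ p hx hy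

  -- b (κ u / m) a = κ (u a) (m b) / m²
  rescale-sign : ∀ {κ u a m b x} (m≢0 : m ≢ 0r) → 0r < κ * ((u * a) * (m * b)) → a * x < 0r →
                 b * (((κ * u) * inv m m≢0) * x) < 0r
  rescale-sign {κ} {u} {a} {m} {b} {x} m≢0 agree ax<0 =
    subst (_< 0r) (*-assoc b _ x) (HasSign-cancel 0ℙ 1ℙ (subst (0r <_) (sym rearrange) positive) ax<0)
    where
    open ≡-Reasoning
    ι = inv m m≢0
    positive : 0r < (κ * ((u * a) * (m * b))) * (ι * ι)
    positive = *-pos agree (0<x*x (inv-≢0 m≢0))
    rearrange : (b * ((κ * u) * ι)) * a ≡ (κ * ((u * a) * (m * b))) * (ι * ι)
    rearrange = begin
      c                          ≡⟨ sym (*-identityʳ c) ⟩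
      c * 1r                     ≡⟨ cong (c *_) (sym (inv-correct m m≢0)) ⟩
      c * (m * ι)
        ≡⟨ solve 6 (λ a b k u m ι → ((b :* ((k :* u) :* ι)) :* a) :* (m :* ι)
                                   := (k :* ((u :* a) :* (m :* b))) :* (ι :* ι)) refl a b κ u m ι ⟩
      (κ * ((u * a) * (m * b))) * (ι * ι) ∎
      where c = (b * ((κ * u) * ι)) * a

  open import Algebra.Properties.Semiring.Sum semiring
    using (sum; sum-remove; ∑-distrib-+; *-distribˡ-sum; sum-cong-≗; sum-permute; sum-replicate-zero)
  open import Algebra.Definitions.RawMonoid *-rawMonoid using () renaming (sum to product)

  sumF≡sum : ∀ {n} (f : Fin n → R) → sumF F f ≡ sum f
  sumF≡sum {zero}  f = refl
  sumF≡sum {suc n} f = cong (f Fin.zero +_) (sumF≡sum (f ∘ Fin.suc))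

  dot≡sum : ∀ {n} (c x : Fin n → R) → dot F c x ≡ sum (λ j → c j * x j)
  dot≡sum c x = sumF≡sum (λ j → c j * x j)

  HasWeakSign-sum : ∀ p {n} (x : Fin n → R) → (∀ j → HasWeakSign p (x j)) → HasWeakSign p (sum x)
  HasWeakSign-sum p {zero}  x hx = inj₁ refl
  HasWeakSign-sum p {suc n} x hx = HasWeakSign-+ p (hx Fin.zero) (HasWeakSign-sum p (x ∘ Fin.suc) (hx ∘ Fin.suc))

  HasSign-sum : ∀ p {n} (x : Fin (suc n) → R) i → HasSign p (x i) → (∀ j → HasWeakSign p (x j)) →
                HasSign p (sum x)
  HasSign-sum p x i hxi hx = subst (HasSign p) (sym (sum-remove {i = i} x))
    (HasSign-+-weak p hxi (HasWeakSign-sum p (x ∘ punchIn i) (hx ∘ punchIn i)))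

  HasSign-product : ∀ n k (φ : Fin n → R) →
                    (∀ m → toℕ m ℕ.< k → 0r < φ m) → (∀ m → k ≤ toℕ m → φ m < 0r) →
                    HasSign (parity (n ∸ k)) (product φ)
  HasSign-product zero    zero    φ pos neg = 0<1
  HasSign-product zero    (suc k) φ pos neg = 0<1
  HasSign-product (suc n) zero    φ pos neg = subst (λ p → HasSign p (product φ)) (sym (ℙₚ.+-homo-+ 1 n))
    (HasSign-* 1ℙ (parity n) (neg Fin.zero z≤n)
      (HasSign-product n zero (φ ∘ Fin.suc) (λ _ ()) (λ m _ → neg (Fin.suc m) z≤n)))
  HasSign-product (suc n) (suc k) φ pos neg = HasSign-* 0ℙ (parity (n ∸ k)) (pos Fin.zero (s≤s z≤n))
    (HasSign-product n k (φ ∘ Fin.suc) (λ m m<k → pos (Fin.suc m) (s≤s m<k))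
                                        (λ m k≤m → neg (Fin.suc m) (s≤s k≤m)))

  *-cancelˡ-≡0 : ∀ {x y} → x ≢ 0r → x * y ≡ 0r → y ≡ 0r
  *-cancelˡ-≡0 {x} {y} x≢0 xy≡0 with sign x x≢0 | <-trichotomy 0r y
  ... | p , hx | inj₁ 0<y        = ⊥-elim (HasSign⇒≢0 (p ℙ.+ 0ℙ) (HasSign-* p 0ℙ hx 0<y) xy≡0)
  ... | _      | inj₂ (inj₁ 0≡y) = sym 0≡y
  ... | p , hx | inj₂ (inj₂ y<0) = ⊥-elim (HasSign⇒≢0 (p ℙ.+ 1ℙ) (HasSign-* p 1ℙ hx y<0) xy≡0)

  StrictlyIncreasing⇒Injective : ∀ {n} {t : Fin n → R} → StrictlyIncreasing F t → Injective _≡_ _≡_ t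
  StrictlyIncreasing⇒Injective {t = t} t↑ {i} {j} tᵢ≡tⱼ with Finₚ.<-cmp i j
  ... | tri< i<j _ _ = ⊥-elim (<⇒≢ (t↑ i j i<j) tᵢ≡tⱼ)
  ... | tri≈ _ i≡j _ = i≡j
  ... | tri> _ _ j<i = ⊥-elim (<⇒≢ (t↑ j i j<i) (sym tᵢ≡tⱼ))

  *-≢0 : ∀ {x y} → x ≢ 0r → y ≢ 0r → x * y ≢ 0r
  *-≢0 x≢0 y≢0 = y≢0 ∘ *-cancelˡ-≡0 x≢0

  product-≢0 : ∀ {n} (φ : Fin n → R) → (∀ m → φ m ≢ 0r) → product φ ≢ 0r
  product-≢0 {zero}  φ φ≢0 = 0≢1 ∘ sym
  product-≢0 {suc n} φ φ≢0 = *-≢0 (φ≢0 Fin.zero) (product-≢0 (φ ∘ Fin.suc) (φ≢0 ∘ Fin.suc))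

  product-≡0 : ∀ {n} (φ : Fin n → R) m → φ m ≡ 0r → product φ ≡ 0r
  product-≡0 φ Fin.zero    φ₀≡0 = trans (cong (_* product (φ ∘ Fin.suc)) φ₀≡0) (zeroˡ _)
  product-≡0 φ (Fin.suc m) φₘ≡0 =
    trans (cong (φ Fin.zero *_) (product-≡0 (φ ∘ Fin.suc) m φₘ≡0)) (zeroʳ _)

  horner : ∀ {n} → Vec R n → R → R
  horner []       t = 0r
  horner (c ∷ cs) t = c + t * horner cs t

  IsPoly : ℕ → (R → R) → Set
  IsPoly m f = Σ[ c ∈ Vec R (suc m) ] (∀ t → horner c t ≡ f t)

  IsPoly-cong : ∀ {m f g} → (∀ t → f t ≡ g t) → IsPoly m f → IsPoly m g
  IsPoly-cong f≗g (c , c≗f) = c , λ t → trans (c≗f t) (f≗g t)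

  horner-const : ∀ a t → horner (a ∷ []) t ≡ a
  horner-const a t = trans (cong (a +_) (zeroʳ t)) (+-identityʳ a)

  IsPoly-const : ∀ a → IsPoly 0 (λ _ → a)
  IsPoly-const a = (a ∷ []) , horner-const a

  IsPoly-suc : ∀ {m f} → IsPoly m f → IsPoly (suc m) f
  IsPoly-suc (c , c≗f) = (c ∷ʳ 0r) , λ t → trans (horner-∷ʳ0 c t) (c≗f t)
    where
    horner-∷ʳ0 : ∀ {n} (c : Vec R n) t → horner (c ∷ʳ 0r) t ≡ horner c t
    horner-∷ʳ0 []      t = horner-const 0r t
    horner-∷ʳ0 (x ∷ c) t = cong (λ h → x + t * h) (horner-∷ʳ0 c t)

  IsPoly-≤ : ∀ {m n f} → m ≤ n → IsPoly m f → IsPoly n f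
  IsPoly-≤ {m} {f = f} m≤n p = go (ℕₚ.≤⇒≤′ m≤n)
    where
    go : ∀ {n} → m ℕ.≤′ n → IsPoly n f
    go ℕ.≤′-refl        = p
    go (ℕ.≤′-step m≤′n) = IsPoly-suc (go m≤′n)

  IsPoly-0 : ∀ m → IsPoly m (λ _ → 0r)
  IsPoly-0 m = IsPoly-≤ z≤n (IsPoly-const 0r)

  IsPoly-+ : ∀ {m f g} → IsPoly m f → IsPoly m g → IsPoly m (λ t → f t + g t)
  IsPoly-+ (c , c≗f) (d , d≗g) =
    Vec.zipWith _+_ c d , λ t → trans (horner-+ c d t) (cong₂ _+_ (c≗f t) (d≗g t))
    where
    horner-+ : ∀ {n} (c d : Vec R n) t → horner (Vec.zipWith _+_ c d) t ≡ horner c t + horner d t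
    horner-+ []      []      t = sym (+-identity 0r)
    horner-+ (x ∷ c) (y ∷ d) t = trans (cong (λ h → (x + y) + t * h) (horner-+ c d t))
      (solve 5 (λ x y t h k → (x :+ y) :+ t :* (h :+ k) := (x :+ t :* h) :+ (y :+ t :* k)) refl x y t _ _)

  IsPoly-scale : ∀ {m f} a → IsPoly m f → IsPoly m (λ t → a * f t)
  IsPoly-scale a (c , c≗f) = Vec.map (a *_) c , λ t → trans (horner-scale c t) (cong (a *_) (c≗f t))
    where
    horner-scale : ∀ {n} (c : Vec R n) t → horner (Vec.map (a *_) c) t ≡ a * horner c t
    horner-scale []      t = sym (zeroʳ a)
    horner-scale (x ∷ c) t = trans (cong (λ h → a * x + t * h) (horner-scale c t))
      (solve 4 (λ a x t h → a :* x :+ t :* (a :* h) := a :* (x :+ t :* h)) refl a x t _)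

  IsPoly-*x : ∀ {m f} → IsPoly m f → IsPoly (suc m) (λ t → t * f t)
  IsPoly-*x (c , c≗f) = (0r ∷ c) , λ t → trans (+-identity _) (cong (t *_) (c≗f t))

  IsPoly-*linear : ∀ {m f} a → IsPoly m f → IsPoly (suc m) (λ t → (t + - a) * f t)
  IsPoly-*linear a p = IsPoly-cong (λ t → solve 3 (λ t a y → t :* y :+ (:- a) :* y := (t :- a) :* y) refl t a _)
    (IsPoly-+ (IsPoly-*x p) (IsPoly-suc (IsPoly-scale (- a) p)))

  IsPoly-sum : ∀ {m n} (f : Fin n → R → R) → (∀ i → IsPoly m (f i)) →
               IsPoly m (λ t → sum (λ i → f i t))
  IsPoly-sum {m} {zero}  f p = IsPoly-0 m
  IsPoly-sum {m} {suc n} f p = IsPoly-+ (p Fin.zero) (IsPoly-sum (f ∘ Fin.suc) (p ∘ Fin.suc))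

  IsPoly-product : ∀ n (a : Fin n → R) → IsPoly n (λ t → product (λ i → t + - a i))
  IsPoly-product zero    a = IsPoly-const 1r
  IsPoly-product (suc n) a = IsPoly-*linear (a Fin.zero) (IsPoly-product n (a ∘ Fin.suc))

  horner-divide : ∀ {n} (c : Vec R (suc n)) a →
                  Σ[ q ∈ Vec R n ] (∀ t → horner c t ≡ (t + - a) * horner q t + horner c a)
  horner-divide (x ∷ [])        a = [] , λ t → begin
    horner (x ∷ []) t            ≡⟨ horner-const x t ⟩
    x                            ≡⟨ sym (trans (cong₂ _+_ (zeroʳ _) (horner-const x a)) (+-identity x)) ⟩
    (t + - a) * 0r + horner (x ∷ []) a ∎
    where open ≡-Reasoning
  horner-divide (x ∷ v@(_ ∷ _)) a with horner-divide v a
  ... | q , v≗ = (horner v a ∷ q) , λ t → begin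
    x + t * horner v t                                   ≡⟨ cong (λ h → x + t * h) (v≗ t) ⟩
    x + t * ((t + - a) * horner q t + horner v a)
      ≡⟨ solve 5 (λ x t a h k → x :+ t :* ((t :- a) :* h :+ k) := (t :- a) :* (k :+ t :* h) :+ (x :+ a :* k))
               refl x t a (horner q t) (horner v a) ⟩
    (t + - a) * (horner v a + t * horner q t) + (x + a * horner v a) ∎
    where open ≡-Reasoning

  horner-roots : ∀ m (c : Vec R (suc m)) (r : Fin (suc m) → R) → Injective _≡_ _≡_ r →
                 (∀ i → horner c (r i) ≡ 0r) → ∀ t → horner c t ≡ 0r
  horner-roots zero    (x ∷ []) r r-inj c≗0 t = begin
    horner (x ∷ []) t             ≡⟨ horner-const x t ⟩
    x                             ≡⟨ sym (horner-const x (r Fin.zero)) ⟩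
    horner (x ∷ []) (r Fin.zero)  ≡⟨ c≗0 Fin.zero ⟩
    0r                            ∎
    where open ≡-Reasoning
  horner-roots (suc m) c       r r-inj c≗0 t with horner-divide c (r Fin.zero)
  ... | q , c≗ = begin
    horner c t                                   ≡⟨ c≗ t ⟩
    (t + - r₀) * horner q t + horner c r₀
      ≡⟨ cong₂ (λ h k → (t + - r₀) * h + k) (q≗0 t) (c≗0 Fin.zero) ⟩
    (t + - r₀) * 0r + 0r                         ≡⟨ trans (+-identityʳ _) (zeroʳ _) ⟩
    0r                                           ∎
    where
    open ≡-Reasoning
    r₀ = r Fin.zero
    q-roots : ∀ i → horner q (r (Fin.suc i)) ≡ 0r
    q-roots i = *-cancelˡ-≡0 (Finₚ.0≢1+n ∘ r-inj ∘ y-x≡0⇒x≡y) (begin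
      (rᵢ + - r₀) * horner q rᵢ                ≡⟨ sym (+-identityʳ _) ⟩
      (rᵢ + - r₀) * horner q rᵢ + 0r           ≡⟨ cong ((rᵢ + - r₀) * horner q rᵢ +_) (sym (c≗0 Fin.zero)) ⟩
      (rᵢ + - r₀) * horner q rᵢ + horner c r₀  ≡⟨ sym (c≗ rᵢ) ⟩
      horner c rᵢ                              ≡⟨ c≗0 (Fin.suc i) ⟩
      0r                                       ∎)
      where rᵢ = r (Fin.suc i)
    q≗0 : ∀ t → horner q t ≡ 0r
    q≗0 = horner-roots m q (r ∘ Fin.suc) (Finₚ.suc-injective ∘ r-inj) q-roots

  IsPoly-roots : ∀ {m f} → IsPoly m f → (r : Fin (suc m) → R) → Injective _≡_ _≡_ r →
                 (∀ i → f (r i) ≡ 0r) → ∀ t → f t ≡ 0r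
  IsPoly-roots {m} (c , c≗f) r r-inj f≗0 t =
    trans (sym (c≗f t)) (horner-roots m c r r-inj (λ i → trans (c≗f (r i)) (f≗0 i)) t)

  dot-ν≡horner : ∀ d (c : Fin (suc d) → R) t → dot F c (ν F d t) ≡ horner (tabulate c) t
  dot-ν≡horner d c t = trans (dot≡sum c (ν F d t)) (sum-powers (suc d) c)
    where
    sum-powers : ∀ n (c : Fin n → R) → sum (λ j → c j * pow F t (toℕ j)) ≡ horner (tabulate c) t
    sum-powers zero    c = refl
    sum-powers (suc n) c = cong₂ _+_ (*-identityʳ (c Fin.zero)) (begin
      sum (λ j → c (Fin.suc j) * (t * pow F t (toℕ j)))  ≡⟨ sum-cong-≗ (λ j → x∙yz≈y∙xz (c (Fin.suc j)) t _) ⟩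
      sum (λ j → t * (c (Fin.suc j) * pow F t (toℕ j)))  ≡⟨ sym (*-distribˡ-sum t terms) ⟩
      t * sum terms                                      ≡⟨ cong (t *_) (sum-powers n (c ∘ Fin.suc)) ⟩
      t * horner (tabulate (c ∘ Fin.suc)) t              ∎)
      where
      open ≡-Reasoning
      terms = λ j → c (Fin.suc j) * pow F t (toℕ j)

  -- Lagrange interpolation and the relation among d + 2 nodes

  module Lagrange {d : ℕ} (r : Fin (suc d) → R) (r-inj : Injective _≡_ _≡_ r) where

    denominator : Fin (suc d) → R
    denominator k = product (λ m → r k + - r (punchIn k m))

    denominator≢0 : ∀ k → denominator k ≢ 0r
    denominator≢0 k = product-≢0 _ (λ m → Finₚ.punchInᵢ≢i k m ∘ r-inj ∘ y-x≡0⇒x≡y)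

    basis : Fin (suc d) → R → R
    basis k s = product (λ m → s + - r (punchIn k m)) * inv (denominator k) (denominator≢0 k)

    IsPoly-basis : ∀ k → IsPoly d (basis k)
    IsPoly-basis k = IsPoly-cong (λ s → *-comm _ _)
      (IsPoly-scale (inv (denominator k) (denominator≢0 k)) (IsPoly-product d (r ∘ punchIn k)))

    basis-self : ∀ k → basis k (r k) ≡ 1r
    basis-self k = inv-correct (denominator k) (denominator≢0 k)

    basis-other : ∀ k j → j ≢ k → basis k (r j) ≡ 0r
    basis-other k j j≢k = trans (cong (_* _) (product-≡0 _ (Fin.punchOut k≢j) rⱼ-rⱼ≡0)) (zeroˡ _)
      where
      k≢j = j≢k ∘ sym
      rⱼ-rⱼ≡0 : r j + - r (punchIn k (Fin.punchOut k≢j)) ≡ 0r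
      rⱼ-rⱼ≡0 = trans (cong (λ i → r j + - r i) (Finₚ.punchIn-punchOut k≢j)) (+-inverse (r j))

    interpolant : (Fin (suc d) → R) → R → R
    interpolant v s = sum (λ k → v k * basis k s)

    IsPoly-interpolant : ∀ v → IsPoly d (interpolant v)
    IsPoly-interpolant v = IsPoly-sum (λ k s → v k * basis k s) (λ k → IsPoly-scale (v k) (IsPoly-basis k))

    interpolant-node : ∀ v j → interpolant v (r j) ≡ v j
    interpolant-node v j = begin
      sum (λ k → v k * basis k (r j))                   ≡⟨ sum-remove {i = j} (λ k → v k * basis k (r j)) ⟩
      v j * basis j (r j) + sum (λ m → term (punchIn j m)) ≡⟨ cong₂ _+_ self others ⟩
      v j + 0r                                          ≡⟨ +-identityʳ (v j) ⟩
      v j                                               ∎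
      where
      open ≡-Reasoning
      term = λ k → v k * basis k (r j)
      self : v j * basis j (r j) ≡ v j
      self = trans (cong (v j *_) (basis-self j)) (*-identityʳ (v j))
      others : sum (λ m → term (punchIn j m)) ≡ 0r
      others = trans (sum-cong-≗ (λ m → trans (cong (v (punchIn j m) *_) (basis-other _ j (Finₚ.punchInᵢ≢i j m ∘ sym)))
                                             (zeroʳ _)))
                     (sum-replicate-zero d)

    interpolant-unique : ∀ {f} → IsPoly d f → ∀ s → f s ≡ interpolant (f ∘ r) s
    interpolant-unique {f} f-poly s = y-x≡0⇒x≡y (IsPoly-roots difference-poly r r-inj difference≡0 s)
      where
      difference-poly : IsPoly d (λ s → interpolant (f ∘ r) s + - f s)
      difference-poly = IsPoly-cong (λ s → cong (interpolant (f ∘ r) s +_) (-1*x≈-x _))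
        (IsPoly-+ (IsPoly-interpolant (f ∘ r)) (IsPoly-scale (- 1r) f-poly))
      difference≡0 : ∀ i → interpolant (f ∘ r) (r i) + - f (r i) ≡ 0r
      difference≡0 i = trans (cong (_+ - f (r i)) (interpolant-node (f ∘ r) i)) (+-inverse _)

  -- A polynomial certificate that S spans a face of the points w i · ν(t i).
  Separates : ∀ {N} → ℕ → (w t : Fin N → R) → Subset N → Set
  Separates d w t S =
    Σ[ f ∈ (R → R) ] (IsPoly d f × (∀ i → i ∈ S → f (t i) ≡ 0r) × (∀ i → i ∉ S → w i * f (t i) < 0r))

  Separates-restrict : ∀ {M N d} (e : Fin M → Fin N) {w t : Fin N → R} {S} →
                       Separates d w t S → Separates d (w ∘ e) (t ∘ e) (tabulate (lookup S ∘ e))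
  Separates-restrict e {S = S} (f , f-poly , f≡0 , wf<0) =
    f , f-poly , (λ i i∈ → f≡0 (e i) (Vecₚ.lookup⇒[]= (e i) S (∈-tabulate⁻ i∈))) ,
                 (λ i i∉ → wf<0 (e i) (i∉ ∘ ∈-tabulate⁺ i ∘ Vecₚ.[]=⇒lookup))

  module Circuit {d : ℕ} (t : Fin (suc (suc d)) → R) (t↑ : StrictlyIncreasing F t) where

    open Lagrange (t ∘ Fin.suc) (Finₚ.suc-injective ∘ StrictlyIncreasing⇒Injective t↑)

    -- The affine dependence Σ μⱼ ν(tⱼ) = 0 of d + 2 points on the moment curve, normalised by μ₀ = -1.
    μ : Fin (suc (suc d)) → R
    μ Fin.zero    = - 1r
    μ (Fin.suc k) = basis k (t Fin.zero)

    μ-annihilates : ∀ {f} → IsPoly d f → sum (λ j → μ j * f (t j)) ≡ 0r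
    μ-annihilates {f} f-poly = begin
      - 1r * f t₀ + sum (λ k → basis k t₀ * f (t (Fin.suc k)))  ≡⟨ cong₂ _+_ (-1*x≈-x (f t₀)) interpolation ⟩
      - f t₀ + f t₀                                             ≡⟨ trans (+-comm _ _) (+-inverse (f t₀)) ⟩
      0r                                                        ∎
      where
      open ≡-Reasoning
      t₀ = t Fin.zero
      interpolation : sum (λ k → basis k t₀ * f (t (Fin.suc k))) ≡ f t₀
      interpolation = trans (sum-cong-≗ (λ k → *-comm (basis k t₀) (f (t (Fin.suc k)))))
                            (sym (interpolant-unique f-poly t₀))

    μ-interpolates : ∀ v → sum (λ j → μ j * v j) ≡ 0r → Σ[ f ∈ (R → R) ] (IsPoly d f × (∀ j → f (t j) ≡ v j))
    μ-interpolates v μ·v≡0 = interpolant (v ∘ Fin.suc) , IsPoly-interpolant (v ∘ Fin.suc) , at-node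
      where
      at-node : ∀ j → interpolant (v ∘ Fin.suc) (t j) ≡ v j
      at-node Fin.zero    = trans (sum-cong-≗ (λ k → *-comm (v (Fin.suc k)) (basis k (t Fin.zero))))
                                  (sym (y-x≡0⇒x≡y (begin
        rest + - v Fin.zero          ≡⟨ +-comm _ _ ⟩
        - v Fin.zero + rest          ≡⟨ cong (_+ rest) (sym (-1*x≈-x (v Fin.zero))) ⟩
        sum (λ j → μ j * v j)        ≡⟨ μ·v≡0 ⟩
        0r                           ∎)))
        where
        open ≡-Reasoning
        rest = sum (λ k → basis k (t Fin.zero) * v (Fin.suc k))
      at-node (Fin.suc k) = interpolant-node (v ∘ Fin.suc) k

    μ-sign : ∀ j → HasSign (parity (suc (toℕ j))) (μ j)
    μ-sign Fin.zero    = HasSign-neg 0ℙ 0<1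
    μ-sign (Fin.suc k) = subst (λ p → HasSign p (μ (Fin.suc k))) (parity-∸ (Finₚ.toℕ≤pred[n] k))
      (HasSign-* (parity d) (parity (d ∸ toℕ k)) numerator-sign
        (HasSign-inv (parity (d ∸ toℕ k)) (denominator≢0 k) denominator-sign))
      where
      numerator-sign : HasSign (parity d) (product (λ m → t Fin.zero + - t (Fin.suc (punchIn k m))))
      numerator-sign = HasSign-product d 0 _ (λ _ ()) (λ m _ → <⇒x-y<0 (t↑ _ _ (s≤s z≤n)))
      denominator-sign : HasSign (parity (d ∸ toℕ k)) (denominator k)
      denominator-sign = HasSign-product d (toℕ k) _
        (λ m m<k → <⇒0<y-x (t↑ _ _ (s≤s (punchIn-< k m m<k))))
        (λ m k≤m → <⇒x-y<0 (t↑ _ _ (s≤s (punchIn-> k m k≤m))))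

    -- Every term of Σ μⱼ f(tⱼ) = 0 would vanish or have sign σ + 1ℙ, the j₀-th one strictly.
    constantSign⇒¬Separates : ∀ (w : Fin (suc (suc d)) → R) S σ j₀ → j₀ ∉ S →
                              (∀ j → j ∉ S → HasSign σ (μ j * w j)) → ¬ Separates d w t S
    constantSign⇒¬Separates w S σ j₀ j₀∉S μw-sign (f , f-poly , f≡0 , wf<0) =
      HasSign⇒≢0 (σ ℙ.+ 1ℙ) (HasSign-sum (σ ℙ.+ 1ℙ) term j₀ (term-sign j₀ j₀∉S) term-weak-sign)
                 (μ-annihilates f-poly)
      where
      term : Fin (suc (suc d)) → R
      term j = μ j * f (t j)
      term-sign : ∀ j → j ∉ S → HasSign (σ ℙ.+ 1ℙ) (term j)
      term-sign j j∉S = HasSign-cancel σ 1ℙ (μw-sign j j∉S) (wf<0 j j∉S)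
      term-weak-sign : ∀ j → HasWeakSign (σ ℙ.+ 1ℙ) (term j)
      term-weak-sign j with j ∈? S
      ... | yes j∈S = inj₁ (trans (cong (μ j *_) (f≡0 j j∈S)) (zeroʳ (μ j)))
      ... | no  j∉S = inj₂ (term-sign j j∉S)

    μ≢0 : ∀ j → μ j ≢ 0r
    μ≢0 j = HasSign⇒≢0 (parity (suc (toℕ j))) (μ-sign j)

    rescale : Fin (suc (suc d)) ↔ Fin (suc (suc d)) → R → (Fin (suc (suc d)) → R) → Fin (suc (suc d)) → R
    rescale π κ v j = ((κ * μ (Inverse.from π j)) * inv (μ j) (μ≢0 j)) * v (Inverse.from π j)

    rescale-annihilated : ∀ π κ v → sum (λ i → μ i * v i) ≡ 0r → sum (λ j → μ j * rescale π κ v j) ≡ 0r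
    rescale-annihilated π κ v μ·v≡0 = begin
      sum (λ j → μ j * rescale π κ v j)            ≡⟨ sum-permute (λ j → μ j * rescale π κ v j) π ⟩
      sum (λ i → μ (to i) * rescale π κ v (to i))  ≡⟨ sum-cong-≗ cancel-μ ⟩
      sum (λ i → κ * (μ i * v i))                  ≡⟨ sym (*-distribˡ-sum κ (λ i → μ i * v i)) ⟩
      κ * sum (λ i → μ i * v i)                    ≡⟨ cong (κ *_) μ·v≡0 ⟩
      κ * 0r                                       ≡⟨ zeroʳ κ ⟩
      0r                                           ∎
      where
      open ≡-Reasoning
      open Inverse π using (to; from; strictlyInverseʳ)
      cancel-μ : ∀ i → μ (to i) * rescale π κ v (to i) ≡ κ * (μ i * v i)
      cancel-μ i = begin
        μ (to i) * (((κ * μ (from (to i))) * ι) * v (from (to i)))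
          ≡⟨ cong (λ k → μ (to i) * (((κ * μ k) * ι) * v k)) (strictlyInverseʳ i) ⟩
        μ (to i) * (((κ * μ i) * ι) * v i)
          ≡⟨ solve 5 (λ m k u ι f → m :* (((k :* u) :* ι) :* f) := (m :* ι) :* (k :* (u :* f)))
                   refl (μ (to i)) κ (μ i) ι (v i) ⟩
        (μ (to i) * ι) * (κ * (μ i * v i))
          ≡⟨ cong (_* (κ * (μ i * v i))) (inv-correct (μ (to i)) (μ≢0 (to i))) ⟩
        1r * (κ * (μ i * v i))                   ≡⟨ *-identity _ ⟩
        κ * (μ i * v i)                          ∎
        where ι = inv (μ (to i)) (μ≢0 (to i))

    -- The rescaled values of f₁ are again annihilated by μ, hence interpolated by some f₂ of degree ≤ d.
    Separates-transfer : ∀ (w₁ w₂ : Fin (suc (suc d)) → R) π κ →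
                         (∀ j → 0r < κ * ((μ (Inverse.from π j) * w₁ (Inverse.from π j)) * (μ j * w₂ j))) →
                         ∀ S₁ S₂ → (∀ j → lookup S₁ (Inverse.from π j) ≡ lookup S₂ j) →
                         Separates d w₁ t S₁ → Separates d w₂ t S₂
    Separates-transfer w₁ w₂ π κ agree S₁ S₂ S₁≗S₂ (f₁ , f₁-poly , f₁≡0 , w₁f₁<0) =
      f₂ , f₂-poly , f₂≡0 , w₂f₂<0
      where
      open Inverse π using (from)
      interpolation =
        μ-interpolates (rescale π κ (f₁ ∘ t)) (rescale-annihilated π κ (f₁ ∘ t) (μ-annihilates f₁-poly))
      f₂ = proj₁ interpolation
      f₂-poly = proj₁ (proj₂ interpolation)
      f₂≡ : ∀ j → f₂ (t j) ≡ rescale π κ (f₁ ∘ t) j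
      f₂≡ = proj₂ (proj₂ interpolation)
      f₂≡0 : ∀ j → j ∈ S₂ → f₂ (t j) ≡ 0r
      f₂≡0 j j∈S₂ = trans (f₂≡ j) (trans (cong (_ *_) (f₁≡0 (from j) from-j∈S₁)) (zeroʳ _))
        where from-j∈S₁ = Vecₚ.lookup⇒[]= (from j) S₁ (trans (S₁≗S₂ j) (Vecₚ.[]=⇒lookup j∈S₂))
      w₂f₂<0 : ∀ j → j ∉ S₂ → w₂ j * f₂ (t j) < 0r
      w₂f₂<0 j j∉S₂ = subst (λ y → w₂ j * y < 0r) (sym (f₂≡ j))
                            (rescale-sign (μ≢0 j) (agree j) (w₁f₁<0 (from j) from-j∉S₁))
        where from-j∉S₁ = λ i∈ → j∉S₂ (Vecₚ.lookup⇒[]= j S₂ (trans (sym (S₁≗S₂ j)) (Vecₚ.[]=⇒lookup i∈)))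

    Separates-relabel : ∀ (w₁ w₂ : Fin (suc (suc d)) → R) π κ →
                        (∀ i → 0r < κ * ((μ i * w₁ i) * (μ (Inverse.to π i) * w₂ (Inverse.to π i)))) →
                        ∀ S → Separates d w₁ t (tabulate (lookup S ∘ Inverse.to π)) ⇔ Separates d w₂ t S
    Separates-relabel w₁ w₂ π κ agree S = mk⇔
      (Separates-transfer w₁ w₂ π κ agree∘from _ S
        (λ j → trans (Vecₚ.lookup∘tabulate (lookup S ∘ to) (from j)) (cong (lookup S) (strictlyInverseˡ j))))
      (Separates-transfer w₂ w₁ (flip π) κ (λ i → subst (λ x → 0r < κ * x) (*-comm _ _) (agree i)) S _
        (λ i → sym (Vecₚ.lookup∘tabulate (lookup S ∘ to) i)))
      where
      open Inverse π using (to; from; strictlyInverseˡ)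
      agree∘from : ∀ j → 0r < κ * ((μ (from j) * w₁ (from j)) * (μ j * w₂ j))
      agree∘from j = subst (λ k → 0r < κ * ((μ (from j) * w₁ (from j)) * (μ k * w₂ k)))
                           (strictlyInverseˡ j) (agree (from j))

  -- Faces of weighted points on the moment curve

  dot-linear : ∀ {k} (c ξ x : Fin k → R) a → dot F (λ j → c j + a * ξ j) x ≡ dot F c x + a * dot F ξ x
  dot-linear c ξ x a = begin
    dot F (λ j → c j + a * ξ j) x                        ≡⟨ dot≡sum _ x ⟩
    sum (λ j → (c j + a * ξ j) * x j)                    ≡⟨ sum-cong-≗ (λ j → expand (c j) (ξ j) (x j)) ⟩
    sum (λ j → c j * x j + a * (ξ j * x j))              ≡⟨ ∑-distrib-+ (λ j → c j * x j) (λ j → a * (ξ j * x j)) ⟩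
    sum (λ j → c j * x j) + sum (λ j → a * (ξ j * x j))  ≡⟨ cong (_ +_) (sym (*-distribˡ-sum a (λ j → ξ j * x j))) ⟩
    sum (λ j → c j * x j) + a * sum (λ j → ξ j * x j)    ≡⟨ sym (cong₂ (λ y z → y + a * z) (dot≡sum c x) (dot≡sum ξ x)) ⟩
    dot F c x + a * dot F ξ x                            ∎
    where
    open ≡-Reasoning
    expand : ∀ c ξ x → (c + a * ξ) * x ≡ c * x + a * (ξ * x)
    expand = solve 4 (λ a c ξ x → (c :+ a :* ξ) :* x := c :* x :+ a :* (ξ :* x)) refl a

  module WeightedMomentCurve {N d} (p : Fin N → Fin (suc d) → R) (w t : Fin N → R)
           (dot-p : ∀ i c → dot F c (p i) ≡ w i * dot F c (ν F d (t i)))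
           (ξ : Fin (suc d) → R) (dot-ξ : ∀ i → dot F ξ (p i) ≡ 1r) where

    Separates⇒IsFace : ∀ S → Separates d w t S → IsFace F p S
    Separates⇒IsFace S (f , (c , c≗f) , f≡0 , wf<0) =
      lookup c , 0r , (λ i i∈S → trans (value i) (trans (cong (w i *_) (f≡0 i i∈S)) (zeroʳ _))) ,
                      (λ i i∉S → subst (_< 0r) (sym (value i)) (wf<0 i i∉S))
      where
      value : ∀ i → dot F (lookup c) (p i) ≡ w i * f (t i)
      value i = trans (dot-p i (lookup c)) (cong (w i *_) (begin
        dot F (lookup c) (ν F d (t i))      ≡⟨ dot-ν≡horner d (lookup c) (t i) ⟩
        horner (tabulate (lookup c)) (t i)  ≡⟨ cong (λ c → horner c (t i)) (Vecₚ.tabulate∘lookup c) ⟩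
        horner c (t i)                      ≡⟨ c≗f (t i) ⟩
        f (t i)                             ∎))
        where open ≡-Reasoning

    -- The functional c - b ξ turns a supporting hyperplane c = b into a polynomial f with w f = c - b.
    IsFace⇒Separates : ∀ S → IsFace F p S → Separates d w t S
    IsFace⇒Separates S (c , b , c≡b , c<b) =
      f , (tabulate c′ , λ s → sym (dot-ν≡horner d c′ s)) , f≡0 , wf<0
      where
      c′ : Fin (suc d) → R
      c′ j = c j + - b * ξ j
      f : R → R
      f s = dot F c′ (ν F d s)
      wf≡c-b : ∀ i → w i * f (t i) ≡ dot F c (p i) + - b
      wf≡c-b i = begin
        w i * f (t i)                       ≡⟨ sym (dot-p i c′) ⟩
        dot F c′ (p i)                      ≡⟨ dot-linear c ξ (p i) (- b) ⟩
        dot F c (p i) + - b * dot F ξ (p i) ≡⟨ cong (λ y → dot F c (p i) + - b * y) (dot-ξ i) ⟩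
        dot F c (p i) + - b * 1r            ≡⟨ cong (dot F c (p i) +_) (*-identityʳ (- b)) ⟩
        dot F c (p i) + - b                 ∎
        where open ≡-Reasoning
      w≢0 : ∀ i → w i ≢ 0r
      w≢0 i wᵢ≡0 = 0≢1 (begin
        0r                             ≡⟨ sym (zeroˡ _) ⟩
        0r * dot F ξ (ν F d (t i))     ≡⟨ cong (_* _) (sym wᵢ≡0) ⟩
        w i * dot F ξ (ν F d (t i))    ≡⟨ sym (dot-p i ξ) ⟩
        dot F ξ (p i)                  ≡⟨ dot-ξ i ⟩
        1r                             ∎)
        where open ≡-Reasoning
      f≡0 : ∀ i → i ∈ S → f (t i) ≡ 0r
      f≡0 i i∈S = *-cancelˡ-≡0 (w≢0 i)
                    (trans (wf≡c-b i) (trans (cong (_+ - b) (c≡b i i∈S)) (+-inverse b)))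
      wf<0 : ∀ i → i ∉ S → w i * f (t i) < 0r
      wf<0 i i∉S = subst (_< 0r) (sym (wf≡c-b i)) (<⇒x-y<0 (c<b i i∉S))

  module MomentCurve (d : ℕ) {m} (T : Fin m → R) where

    e₀ : Fin (suc d) → R
    e₀ Fin.zero    = 1r
    e₀ (Fin.suc _) = 0r

    dot-e₀ : ∀ i → dot F e₀ (ν F d (T i)) ≡ 1r
    dot-e₀ i = trans (cong (1r * 1r +_) (trans (dot≡sum (e₀ ∘ Fin.suc) (ν F d (T i) ∘ Fin.suc))
                     (trans (sum-cong-≗ (λ j → zeroˡ (ν F d (T i) (Fin.suc j)))) (sum-replicate-zero d))))
                     (trans (+-identityʳ _) (*-identity 1r))

    open WeightedMomentCurve (λ i → ν F d (T i)) (λ _ → 1r) T (λ i c → sym (*-identity _)) e₀ dot-e₀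
      public

  module VeroneseCurve (d : ℕ) {n} (ξ : Fin (suc d) → R) (T : Fin n → R) (nz : ∀ i → q F d ξ (T i) ≢ 0r)
    where

    weight : Fin n → R
    weight i = inv (q F d ξ (T i)) (nz i)

    dot-veronese : ∀ i c → dot F c (veronesePoints F d ξ T nz i) ≡ weight i * dot F c (ν F d (T i))
    dot-veronese i c = begin
      dot F c (veronesePoints F d ξ T nz i)          ≡⟨ dot≡sum c (veronesePoints F d ξ T nz i) ⟩
      sum (λ j → c j * (weight i * ν F d (T i) j))   ≡⟨ sum-cong-≗ (λ j → x∙yz≈y∙xz (c j) (weight i) (ν F d (T i) j)) ⟩
      sum (λ j → weight i * (c j * ν F d (T i) j))   ≡⟨ sym (*-distribˡ-sum (weight i) terms) ⟩
      weight i * sum terms                           ≡⟨ cong (weight i *_) (sym (dot≡sum c (ν F d (T i)))) ⟩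
      weight i * dot F c (ν F d (T i))               ∎
      where
      open ≡-Reasoning
      terms = λ j → c j * ν F d (T i) j

    dot-ξ : ∀ i → dot F ξ (veronesePoints F d ξ T nz i) ≡ 1r
    dot-ξ i = trans (dot-veronese i ξ) (trans (*-comm _ _) (inv-correct _ (nz i)))

    open WeightedMomentCurve (veronesePoints F d ξ T nz) weight T dot-veronese ξ dot-ξ public

    weight-sign : ∀ {k} → TwoRunSplit F d ξ T k →
                  ∃[ ε ] ((∀ i → toℕ i ℕ.< k → HasSign (ε ℙ.+ 0ℙ) (weight i)) ×
                          (∀ i → k ≤ toℕ i → HasSign (ε ℙ.+ 1ℙ) (weight i)))
    weight-sign {k} (0<k , k<n , same₁ , _ , opposite) = ε , below , above
      where
      i₀ : Fin n
      i₀ = Fin.fromℕ< (ℕₚ.<-trans 0<k k<n)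
      i₀<k : toℕ i₀ ℕ.< k
      i₀<k = subst (ℕ._< k) (sym (Finₚ.toℕ-fromℕ< _)) 0<k
      ε = proj₁ (sign (q F d ξ (T i₀)) (nz i₀))
      q₀-sign = proj₂ (sign (q F d ξ (T i₀)) (nz i₀))
      below : ∀ i → toℕ i ℕ.< k → HasSign (ε ℙ.+ 0ℙ) (weight i)
      below i i<k = HasSign-inv (ε ℙ.+ 0ℙ) (nz i) (HasSign-factor ε 0ℙ q₀-sign (same₁ i₀ i i₀<k i<k))
      above : ∀ i → k ≤ toℕ i → HasSign (ε ℙ.+ 1ℙ) (weight i)
      above i k≤i = HasSign-inv (ε ℙ.+ 1ℙ) (nz i) (HasSign-factor ε 1ℙ q₀-sign (opposite i₀ i i₀<k k≤i))

  -- Cyclic polytopes are neighbourly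

  squares : ∀ {m} → Subset m → (Fin m → R) → R → R
  squares []          T s = 1r
  squares (true ∷ S)  T s = ((s + - T Fin.zero) * (s + - T Fin.zero)) * squares S (T ∘ Fin.suc) s
  squares (false ∷ S) T s = squares S (T ∘ Fin.suc) s

  IsPoly-squares : ∀ {m} (S : Subset m) T → IsPoly (∣ S ∣ ℕ.* 2) (squares S T)
  IsPoly-squares []          T = IsPoly-const 1r
  IsPoly-squares (true ∷ S)  T = IsPoly-cong (λ s → sym (*-assoc _ _ _))
    (IsPoly-*linear (T Fin.zero) (IsPoly-*linear (T Fin.zero) (IsPoly-squares S (T ∘ Fin.suc))))
  IsPoly-squares (false ∷ S) T = IsPoly-squares S (T ∘ Fin.suc)

  squares-≡0 : ∀ {m} {S : Subset m} {i} T → i ∈ S → squares S T (T i) ≡ 0r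
  squares-≡0 {S = true ∷ S}  T here = begin
    (x * x) * rest     ≡⟨ cong (λ y → (y * y) * rest) (+-inverse _) ⟩
    (0r * 0r) * rest   ≡⟨ trans (cong (_* rest) (zeroˡ 0r)) (zeroˡ rest) ⟩
    0r                 ∎
    where
    open ≡-Reasoning
    x = T Fin.zero + - T Fin.zero
    rest = squares S (T ∘ Fin.suc) (T Fin.zero)
  squares-≡0 {S = true ∷ S}  T (there i∈S) = trans (cong (_ *_) (squares-≡0 (T ∘ Fin.suc) i∈S)) (zeroʳ _)
  squares-≡0 {S = false ∷ S} T (there i∈S) = squares-≡0 (T ∘ Fin.suc) i∈S

  squares-pos : ∀ {m} (S : Subset m) T s → (∀ j → j ∈ S → T j ≢ s) → 0r < squares S T s
  squares-pos []          T s T≢s = 0<1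
  squares-pos (true ∷ S)  T s T≢s = *-pos (0<x*x (T≢s Fin.zero here ∘ y-x≡0⇒x≡y))
    (squares-pos S (T ∘ Fin.suc) s (λ j j∈S → T≢s (Fin.suc j) (there j∈S)))
  squares-pos (false ∷ S) T s T≢s = squares-pos S (T ∘ Fin.suc) s (λ j j∈S → T≢s (Fin.suc j) (there j∈S))

  moment-neighbourly : ∀ d {m} (T : Fin m → R) → StrictlyIncreasing F T →
                       Neighbourly F ⌊ d /2⌋ (λ i → ν F d (T i))
  moment-neighbourly d T T↑ S ∣S∣≤ = Separates⇒IsFace S (f , f-poly , f≡0 , f<0)
    where
    open MomentCurve d T
    f : R → R
    f s = - squares S T s
    f-poly : IsPoly d f
    f-poly = IsPoly-≤ (ℕₚ.≤-trans (ℕₚ.*-monoˡ-≤ 2 ∣S∣≤) (⌊n/2⌋*2≤n d))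
      (IsPoly-cong (λ s → -1*x≈-x _) (IsPoly-scale (- 1r) (IsPoly-squares S T)))
    f≡0 : ∀ i → i ∈ S → f (T i) ≡ 0r
    f≡0 i i∈S = trans (cong -_ (squares-≡0 T i∈S)) -0#≈0#
    f<0 : ∀ i → i ∉ S → 1r * f (T i) < 0r
    f<0 i i∉S = subst (_< 0r) (sym (*-identity _)) (HasSign-neg 0ℙ (squares-pos S T (T i)
      (λ j j∈S Tⱼ≡Tᵢ → i∉S (subst (_∈ S) (StrictlyIncreasing⇒Injective T↑ Tⱼ≡Tᵢ) j∈S))))

  Cyclic⇒Neighbourly : ∀ {m D} d (p : Fin m → Fin D → R) → Cyclic F d p → Neighbourly F ⌊ d /2⌋ p
  Cyclic⇒Neighbourly d p (m′ , T′ , T′↑ , f , faces) S ∣S∣≤ =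
    subst (IsFace F p) relabel-back (Equivalence.from (faces S′) (moment-neighbourly d T′ T′↑ S′ ∣S′∣≤))
    where
    S′ : Subset m′
    S′ = tabulate (lookup S ∘ Inverse.from f)
    ∣S′∣≤ : ∣ S′ ∣ ≤ ⌊ d /2⌋
    ∣S′∣≤ = subst (_≤ ⌊ d /2⌋) (sym (∣∣-relabel f S)) ∣S∣≤
    relabel-back : tabulate (λ i → lookup S′ (Inverse.to f i)) ≡ S
    relabel-back = trans (Vecₚ.tabulate-cong (λ i → trans (Vecₚ.lookup∘tabulate _ (Inverse.to f i))
                                                          (cong (lookup S) (Inverse.strictlyInverseʳ f i))))
                         (Vecₚ.tabulate∘lookup S)

  -- Veronese polytopes with two runs

  signUnit : Parity → R
  signUnit 0ℙ = 1r
  signUnit 1ℙ = - 1r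

  HasSign-signUnit : ∀ p → HasSign p (signUnit p)
  HasSign-signUnit 0ℙ = 0<1
  HasSign-signUnit 1ℙ = HasSign-neg 0ℙ 0<1

  -- π exchanges neighbouring nodes of I₂; as μ alternates in sign, this compensates the sign change of
  -- the weights on I₂, and the signs of μⱼ wⱼ and μ_{π j} agree up to the global sign ε.
  veronese-cyclic : ∀ {d n} → 2 ∣ d → n ≡ suc (suc d) → (T : Fin n → R) → StrictlyIncreasing F T →
                    (ξ : Fin (suc d) → R) (nz : ∀ i → q F d ξ (T i) ≢ 0r) →
                    ∀ {k} → TwoRunSplit F d ξ T k → 2 ∣ k → Cyclic F d (veronesePoints F d ξ T nz)
  veronese-cyclic {d} (divides m refl) refl T T↑ ξ nz split (divides h refl) = suc (suc d) , T , T↑ , π , faces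
    where
    open Circuit T T↑ using (μ; μ-sign; Separates-relabel)
    module V = VeroneseCurve d ξ T nz
    module M = MomentCurve d T
    π : Fin (suc (suc d)) ↔ Fin (suc (suc d))
    π = swapPairsFrom↔ h (suc m)
    open Inverse π using (to)
    ε = proj₁ (V.weight-sign split)
    below = proj₁ (proj₂ (V.weight-sign split))
    above = proj₂ (proj₂ (V.weight-sign split))
    κ = signUnit ε
    signs-cancel : ∀ ε a s → ε ℙ.+ ((a ℙ.+ (ε ℙ.+ s)) ℙ.+ ((a ℙ.+ s) ℙ.+ 0ℙ)) ≡ 0ℙ
    signs-cancel 0ℙ 0ℙ 0ℙ = refl
    signs-cancel 0ℙ 0ℙ 1ℙ = refl
    signs-cancel 0ℙ 1ℙ 0ℙ = refl
    signs-cancel 0ℙ 1ℙ 1ℙ = refl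
    signs-cancel 1ℙ 0ℙ 0ℙ = refl
    signs-cancel 1ℙ 0ℙ 1ℙ = refl
    signs-cancel 1ℙ 1ℙ 0ℙ = refl
    signs-cancel 1ℙ 1ℙ 1ℙ = refl
    agree-at : ∀ i s → HasSign (ε ℙ.+ s) (V.weight i) →
               parity (suc (toℕ (to i))) ≡ parity (suc (toℕ i)) ℙ.+ s →
               0r < κ * ((μ i * V.weight i) * (μ (to i) * 1r))
    agree-at i s weight-sign parity-to =
      subst (λ p → HasSign p (κ * ((μ i * V.weight i) * (μ (to i) * 1r)))) (signs-cancel ε a s)
      (HasSign-* ε ((a ℙ.+ (ε ℙ.+ s)) ℙ.+ ((a ℙ.+ s) ℙ.+ 0ℙ)) (HasSign-signUnit ε)
        (HasSign-* (a ℙ.+ (ε ℙ.+ s)) ((a ℙ.+ s) ℙ.+ 0ℙ) (HasSign-* a (ε ℙ.+ s) (μ-sign i) weight-sign)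
                       (HasSign-* (a ℙ.+ s) 0ℙ μ-to-sign 0<1)))
      where
      a = parity (suc (toℕ i))
      μ-to-sign = subst (λ p → HasSign p (μ (to i))) parity-to (μ-sign (to i))
    signs-agree : ∀ i → 0r < κ * ((μ i * V.weight i) * (μ (to i) * 1r))
    signs-agree i with toℕ i ℕₚ.<? h ℕ.* 2
    ... | yes i<k = agree-at i 0ℙ (below i i<k) (begin
      parity (suc (toℕ (to i)))     ≡⟨ cong (parity ∘ suc) (toℕ-swapPairsFromFin h (suc m) i) ⟩
      parity (suc (swapPairsFrom h (toℕ i))) ≡⟨ cong (parity ∘ suc) (swapPairsFrom-below h (toℕ i) i<k) ⟩
      parity (suc (toℕ i))          ≡⟨ sym (ℙₚ.+-identityʳ _) ⟩
      parity (suc (toℕ i)) ℙ.+ 0ℙ   ∎)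
      where open ≡-Reasoning
    ... | no  i≮k = agree-at i 1ℙ (above i k≤i)
      (trans (cong (parity ∘ suc) (toℕ-swapPairsFromFin h (suc m) i)) (swapPairsFrom-parity h (toℕ i) k≤i))
      where k≤i = ℕₚ.≮⇒≥ i≮k
    faces : ∀ S → IsFace F (veronesePoints F d ξ T nz) (tabulate (lookup S ∘ to)) ⇔
                  IsFace F (λ i → ν F d (T i)) S
    faces S = mk⇔
      (M.Separates⇒IsFace S ∘ Equivalence.to (relabel S) ∘ V.IsFace⇒Separates _)
      (V.Separates⇒IsFace _ ∘ Equivalence.from (relabel S) ∘ M.IsFace⇒Separates S)
      where relabel = Separates-relabel V.weight (λ _ → 1r) π κ signs-agree

  -- Outside the subset the signs of μⱼ wⱼ on the window are all ε + 1ℙ.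
  veronese-¬IsFace : ∀ {d n} (ξ : Fin (suc d) → R) (T : Fin n → R) → StrictlyIncreasing F T →
                     (nz : ∀ i → q F d ξ (T i) ≢ 0r) → ∀ {k} → TwoRunSplit F d ξ T k → (W : OddWindow d n k) →
                     ¬ IsFace F (veronesePoints F d ξ T nz) (OddWindow.subset W)
  veronese-¬IsFace {d} ξ T T↑ nz split W face =
    constantSign⇒¬Separates (weight ∘ index) restricted (ε ℙ.+ 1ℙ) Fin.zero 0∉restricted same-sign
      (Separates-restrict index (IsFace⇒Separates subset face))
    where
    open OddWindow W
    open VeroneseCurve d ξ T nz using (weight; weight-sign; IsFace⇒Separates)
    open Circuit (T ∘ index) (λ i j i<j → T↑ (index i) (index j) (index-mono i j i<j))
      using (μ; μ-sign; constantSign⇒¬Separates)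
    ε = proj₁ (weight-sign split)
    below = proj₁ (proj₂ (weight-sign split))
    above = proj₂ (proj₂ (weight-sign split))
    μ-sign′ : ∀ {j p} → parity (toℕ j) ≡ p → HasSign (p ⁻¹) (μ j)
    μ-sign′ {j} parityⱼ =
      subst (λ p → HasSign p (μ j)) (trans (parity-suc (toℕ j)) (cong _⁻¹ parityⱼ)) (μ-sign j)
    same-sign : ∀ j → j ∉ restricted → HasSign (ε ℙ.+ 1ℙ) (μ j * weight (index j))
    same-sign j j∉ with ∉restricted-parity j j∉
    ... | inj₁ (j<a , j-even) = subst (λ p → HasSign p (μ j * weight (index j))) (1ℙ+[ε+0ℙ] ε)
      (HasSign-* 1ℙ (ε ℙ.+ 0ℙ) (μ-sign′ {j} j-even) (below (index j) (index-below j j<a)))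
      where
      1ℙ+[ε+0ℙ] : ∀ ε → 1ℙ ℙ.+ (ε ℙ.+ 0ℙ) ≡ ε ℙ.+ 1ℙ
      1ℙ+[ε+0ℙ] 0ℙ = refl
      1ℙ+[ε+0ℙ] 1ℙ = refl
    ... | inj₂ (a≤j , j-odd)  =
      HasSign-* 0ℙ (ε ℙ.+ 1ℙ) (μ-sign′ {j} j-odd) (above (index j) (index-above j a≤j))

  veronese-not-neighbourly : ∀ {d n} (ξ : Fin (suc d) → R) (T : Fin n → R) → StrictlyIncreasing F T →
                             (nz : ∀ i → q F d ξ (T i) ≢ 0r) → ∀ {k} → TwoRunSplit F d ξ T k → OddWindow d n k →
                             ¬ Neighbourly F ⌊ d /2⌋ (veronesePoints F d ξ T nz) ×
                             ¬ Cyclic F d (veronesePoints F d ξ T nz)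
  veronese-not-neighbourly {d} ξ T T↑ nz split W =
    (λ neighbourly → ¬face (neighbourly subset ∣subset∣≤)) ,
    (λ cyclic → ¬face (Cyclic⇒Neighbourly d (veronesePoints F d ξ T nz) cyclic subset ∣subset∣≤))
    where
    open OddWindow W using (subset; ∣subset∣≤)
    ¬face = veronese-¬IsFace ξ T T↑ nz split W

open import Data.Nat using (_+_; _<_)

proposition3p20 : (F : RealField) → (d n : ℕ) → 4 ≤ d → 2 ∣ d → suc d ≤ n →
    (T : Fin n → RealField.R F) → StrictlyIncreasing F T →
    (ξ : Fin (suc d) → RealField.R F) →
    (nz : ∀ i → ¬ (q F d ξ (T i) ≡ RealField.0r F)) →
    (k : ℕ) → TwoRunSplit F d ξ T k →
    ((n ≡ d + 2 → 2 ∣ k → 2 ∣ (n ∸ k) →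
        Cyclic F d (veronesePoints F d ξ T nz)) ×
     (n ≡ d + 2 → ¬ (2 ∣ k) → ¬ (2 ∣ (n ∸ k)) →
        ¬ Neighbourly F ⌊ d /2⌋ (veronesePoints F d ξ T nz) ×
        ¬ Cyclic F d (veronesePoints F d ξ T nz)) ×
     (d + 2 < n →
        ¬ Neighbourly F ⌊ d /2⌋ (veronesePoints F d ξ T nz) ×
        ¬ Cyclic F d (veronesePoints F d ξ T nz)))
proposition3p20 F d n _ 2∣d _ T T↑ ξ nz k split =
  (λ n≡d+2 2∣k _ → veronese-cyclic F 2∣d (trans n≡d+2 (ℕₚ.+-comm d 2)) T T↑ ξ nz split 2∣k) ,
  (λ n≡d+2 k-odd _ → veronese-not-neighbourly F ξ T T↑ nz split (oddWindow-exact 2∣d n≡d+2 k<n k-odd)) ,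
  (λ d+2<n → veronese-not-neighbourly F ξ T T↑ nz split (oddWindow-large 2∣d d+2<n (proj₁ split) k<n))
  where
  k<n : k < n
  k<n = proj₁ (proj₂ split)
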